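{- Let $G_1,G_2$ be simple connected graphs, each with at least one edge, with $m_1=|E(G_1)|$, $m_2=|E(G_2)|$, and let $G=G_1\oplus_vG_2$, $m=m_1+m_2$. Let $\mathscr L$ be a set of $l$ pairs of distinct vertices of $G_2$ that are not edges of $G$, let $\widehat G$ be the graph obtained from $G$ by adding the pairs in $\mathscr L$ as edges, and let $\widehat G_2$ be the graph obtained from $G_2$ by adding $\mathscr L$ (so $\widehat G=G_1\oplus_v\widehat G_2$). Set $A=\mu(\widehat G_2,v)-\mu(G_2,v)$, $B=\mathscr{K}(\widehat G_2)-\mu(G_2,v)$, $C=\mathscr{K}(\widehat G_2)-\mathscr{K}(G_2)$. Then $$\mathscr{K}(\widehat G)-\mathscr{K}(G)=\frac{lm_1(\mu(G_1,v)-\mathscr{K}(G_1))}{m(m+l)}+\frac{Am_1^2+((A+C)m_2+Bl)m_1+C(m_2^2+lm_2)}{m(m+l)}.$$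
   Context: All graphs are finite, simple, undirected. For a connected graph $H$ with Laplacian $L$, the effective resistance is $r_H(i,j)=(e_i-e_j)^TL^\dagger(e_i-e_j)$ ($L^\dagger$ the Moore–Penrose pseudoinverse), i.e. resistance with unit resistors on edges. For a connected graph $H$ with $m\ge1$ edges and degrees $d_i$, Kemeny's constant is $\mathscr{K}(H)=\sum_j\pi_jm_{ij}$ for the simple random walk ($\pi_j=d_j/2m$, $m_{ij}$ expected hitting time of $j$ from $i$, $m_{jj}=0$), equal to $\frac1{4m}\sum_{i,j}d_id_jr_H(i,j)$. The moment of a vertex $v$ of $H$ is $\mu(H,v)=\sum_{i\in V(H)}d_ir_H(i,v)$. $G_1\oplus_vG_2$ denotes the 1-sum: the disjoint union of $G_1$ and $G_2$ with a chosen vertex of each identified into a single vertex $v$. -}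

module Defs where

open import Data.Nat as ℕ using (ℕ; zero; suc)
open import Data.Integer using (+_)
open import Data.Rational using (ℚ; 0ℚ; _/_) renaming (_+_ to _+q_; _*_ to _*q_; _-_ to _-q_)
open import Data.Fin using (Fin; zero; suc; toℕ; _≟_; _↑ˡ_; _↑ʳ_; punchOut)
open import Data.Bool using (Bool; true; false; if_then_else_; _∧_; _∨_)
open import Data.List using (List; []; _∷_; map; length)
open import Data.List.Relation.Unary.AllPairs using (AllPairs)
open import Data.List.Relation.Unary.All using (All)
open import Data.Product using (_×_; _,_)
open import Data.Sum using (_⊎_)
open import Relation.Binary.PropositionalEquality using (_≡_; _≢_)
open import Relation.Nullary using (¬_; yes; no)
open import Relation.Nullary.Decidable using (⌊_⌋)
open import Function using (_∘_)

sumℚ : ∀ {n} → (Fin n → ℚ) → ℚ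
sumℚ {zero}  f = 0ℚ
sumℚ {suc n} f = f zero +q sumℚ (f ∘ suc)

sumℕ : ∀ {n} → (Fin n → ℕ) → ℕ
sumℕ {zero}  f = 0
sumℕ {suc n} f = f zero ℕ.+ sumℕ (f ∘ suc)

anyFin : ∀ {n} → (Fin n → Bool) → Bool
anyFin {zero}  f = false
anyFin {suc n} f = f zero ∨ anyFin (f ∘ suc)

anyList : ∀ {A : Set} → (A → Bool) → List A → Bool
anyList p []       = false
anyList p (x ∷ xs) = p x ∨ anyList p xs

ℕtoℚ : ℕ → ℚ
ℕtoℚ k = + k / 1

-- q / k for k ≥ 1 (and 0 when k = 0; only used with k ≥ 1)
divℕ : ℚ → ℕ → ℚ
divℕ q zero    = 0ℚ
divℕ q (suc k) = q *q (+ 1 / suc k)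

_==_ : ∀ {n} → Fin n → Fin n → Bool
i == j = ⌊ i ≟ j ⌋

Graph : ℕ → Set
Graph n = Fin n → Fin n → Bool

IsSimple : ∀ {n} → Graph n → Set
IsSimple {n} H = (∀ (i j : Fin n) → H i j ≡ H j i) × (∀ (i : Fin n) → H i i ≡ false)

data Reach {n} (H : Graph n) : Fin n → Fin n → Set where
  here : ∀ {i} → Reach H i i
  step : ∀ {i k j} → H i k ≡ true → Reach H k j → Reach H i j

Connected : ∀ {n} → Graph n → Set
Connected {n} H = ∀ (i j : Fin n) → Reach H i j

deg : ∀ {n} → Graph n → Fin n → ℕ
deg H i = sumℕ (λ j → if H i j then 1 else 0)

edges : ∀ {n} → Graph n → ℕ
edges H = sumℕ (λ i → sumℕ (λ j → if H i j ∧ (toℕ i ℕ.<ᵇ toℕ j) then 1 else 0))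

Mat : ℕ → Set
Mat n = Fin n → Fin n → ℚ

_⊗_ : ∀ {n} → Mat n → Mat n → Mat n
(A ⊗ B) i j = sumℚ (λ k → A i k *q B k j)

transpose : ∀ {n} → Mat n → Mat n
transpose A i j = A j i

laplacian : ∀ {n} → Graph n → Mat n
laplacian H i j =
  if i == j then ℕtoℚ (deg H i)
  else (if H i j then (+ 0 / 1) -q (+ 1 / 1) else 0ℚ)

IsPseudoInverse : ∀ {n} → Mat n → Mat n → Set
IsPseudoInverse L X =
  ((L ⊗ X) ⊗ L ≡ L) × ((X ⊗ L) ⊗ X ≡ X) ×
  (transpose (L ⊗ X) ≡ L ⊗ X) × (transpose (X ⊗ L) ≡ X ⊗ L)

-- effective resistance (e_i - e_j)ᵀ X (e_i - e_j), X = L†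
resistance : ∀ {n} → Mat n → Fin n → Fin n → ℚ
resistance X i j = ((X i i +q X j j) -q X i j) -q X j i

moment : ∀ {n} → Graph n → Mat n → Fin n → ℚ
moment H X v = sumℚ (λ i → ℕtoℚ (deg H i) *q resistance X i v)

kemeny : ∀ {n} → Graph n → Mat n → ℚ
kemeny H X =
  divℕ (sumℚ (λ i → sumℚ (λ j →
          (ℕtoℚ (deg H i) *q ℕtoℚ (deg H j)) *q resistance X i j)))
       (4 ℕ.* edges H)

-- 1-sum G₁ ⊕_v G₂ : vertex v₁ of G₁ (on Fin n₁) identified with vertex
-- v₂ of G₂ (on Fin (suc k)); result on Fin (n₁ + k).  G₁'s vertices keep
-- their indices; the other vertices of G₂ come after them.

emb₁ : ∀ {n₁} k → Fin n₁ → Fin (n₁ ℕ.+ k)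
emb₁ k a = a ↑ˡ k

emb₂ : ∀ {n₁ k} → Fin n₁ → Fin (suc k) → Fin (suc k) → Fin (n₁ ℕ.+ k)
emb₂ {n₁} {k} v₁ v₂ w with v₂ ≟ w
... | yes _ = v₁ ↑ˡ k
... | no ne = n₁ ↑ʳ punchOut ne

oneSum : ∀ {n₁ k} → Graph n₁ → Fin n₁ → Graph (suc k) → Fin (suc k) → Graph (n₁ ℕ.+ k)
oneSum {n₁} {k} G₁ v₁ G₂ v₂ i j =
  anyFin (λ a → anyFin (λ b → G₁ a b ∧ (emb₁ k a == i) ∧ (emb₁ k b == j)))
  ∨ anyFin (λ a → anyFin (λ b → G₂ a b ∧ (emb₂ v₁ v₂ a == i) ∧ (emb₂ v₁ v₂ b == j)))

addEdges : ∀ {n} → Graph n → List (Fin n × Fin n) → Graph n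
addEdges H 𝓛 i j =
  H i j ∨ anyList (λ { (a , b) → ((a == i) ∧ (b == j)) ∨ ((a == j) ∧ (b == i)) }) 𝓛

mapPair : ∀ {A B : Set} → (A → B) → A × A → B × B
mapPair f (a , b) = f a , f b

SamePair : ∀ {n} → Fin n × Fin n → Fin n × Fin n → Set
SamePair (a , b) (c , d) = ((a ≡ c) × (b ≡ d)) ⊎ ((a ≡ d) × (b ≡ c))

{-# OPTIONS --safe #-}
-- Kemeny's constant is a degree-weighted sum of moments: 4m·𝒦(H) = Σᵢ dᵢ μ(H,i).
-- Effective resistances are quadratic forms of a generalized inverse X of the
-- Laplacian (L X L = L suffices), and on a 1-sum the potentials of the two sides
-- glue at the cut vertex v.  Hence resistances inside G₁ or G₂ are unchanged and
-- r(a,w) = r₁(a,v) + r₂(v,w) across v, which gives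
--   (m₁ + m₂)·𝒦(G₁ ⊕ G₂) = m₁𝒦(G₁) + m₂𝒦(G₂) + m₂μ(G₁,v) + m₁μ(G₂,v).
-- Applying this to G = G₁ ⊕ G₂ and Ĝ = G₁ ⊕ Ĝ₂, where Ĝ₂ has m₂ + l edges, and
-- subtracting yields the formula.
module Submission where

open import Defs
open import Data.Nat using (ℕ; suc; _≥_)
open import Data.Fin using (Fin)
open import Data.Bool using (false)
open import Data.List using (List; map; length)
open import Data.List.Relation.Unary.All using (All)
open import Data.List.Relation.Unary.AllPairs using (AllPairs)
open import Data.Product using (_×_; _,_; proj₁; proj₂)
open import Data.Rational using (ℚ) renaming (_+_ to _+q_; _*_ to _*q_; _-_ to _-q_)
open import Relation.Binary.PropositionalEquality using (_≡_; _≢_)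
open import Relation.Nullary using (¬_)

import Algebra.Properties.Group
import Algebra.Properties.Ring
open import Data.Bool using (Bool; true; if_then_else_; _∧_; _∨_)
import Data.Bool.Properties as BoolP
open import Data.Empty using (⊥; ⊥-elim)
open import Data.Fin using (zero; suc; toℕ; _↑ˡ_; _↑ʳ_; punchIn; punchOut; splitAt)
import Data.Fin as F
import Data.Fin.Properties as FP
open import Data.Integer as ℤ using (+_)
import Data.Integer.Properties as ℤP
open import Data.List using ([]; _∷_)
open import Data.List.Membership.Propositional using (find)
import Data.List.Relation.Unary.All as All
import Data.List.Relation.Unary.AllPairs as AllPairs
open import Data.List.Relation.Unary.Any as Any using (Any; here; there)
import Data.List.Relation.Unary.Any.Properties as AnyP
import Data.Nat as ℕ
open import Data.Nat.Coprimality using (1-coprimeTo) renaming (sym to coprime-sym)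
import Data.Nat.Properties as ℕP
open import Data.Product using (∃)
open import Data.Rational as Q using (0ℚ; 1ℚ; mkℚ; ↥_; 1/_) renaming (_≤_ to _≤q_)
import Data.Rational.Properties as ℚP
open import Data.Rational.Solver using (module +-*-Solver)
open +-*-Solver using (solve; _:=_; _:+_; _:-_; _:*_; con)
open import Data.Sum using (_⊎_; inj₁; inj₂; [_,_]′)
open import Function using (_∘_)
open import Function.Definitions using (Injective)
open import Relation.Binary.Definitions using (tri<; tri≈; tri>)
open import Relation.Binary.PropositionalEquality using (refl; sym; trans; cong; cong₂; cong-app; subst; subst₂; module ≡-Reasoning)
open import Relation.Nullary using (yes; no)

module ℚ-group = Algebra.Properties.Group ℚP.+-0-group
module ℚ-ring = Algebra.Properties.Ring ℚP.+-*-ring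

ℕtoℚ-mkℚ : ∀ k → ℕtoℚ k ≡ mkℚ (+ k) 0 (coprime-sym (1-coprimeTo k))
ℕtoℚ-mkℚ k = ℚP.normalize-coprime (coprime-sym (1-coprimeTo k))

ℕtoℚ-+ : ∀ a b → ℕtoℚ (a ℕ.+ b) ≡ ℕtoℚ a +q ℕtoℚ b
ℕtoℚ-+ a b rewrite ℕtoℚ-mkℚ a | ℕtoℚ-mkℚ b =
  ℚP./-cong {p₁ = + (a ℕ.+ b)} (cong₂ ℤ._+_ (sym (ℤP.*-identityʳ (+ a))) (sym (ℤP.*-identityʳ (+ b)))) refl

ℕtoℚ-* : ∀ a b → ℕtoℚ (a ℕ.* b) ≡ ℕtoℚ a *q ℕtoℚ b
ℕtoℚ-* a b rewrite ℕtoℚ-mkℚ a | ℕtoℚ-mkℚ b =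
  ℚP./-cong {p₁ = + (a ℕ.* b)} (sym (ℤP.+◃n≡+n (a ℕ.* b))) refl

ℕtoℚ-injective : ∀ {a b} → ℕtoℚ a ≡ ℕtoℚ b → a ≡ b
ℕtoℚ-injective {a} {b} eq =
  ℤP.+-injective (cong ↥_ (trans (sym (ℕtoℚ-mkℚ a)) (trans eq (ℕtoℚ-mkℚ b))))

divℕ-*-cancel : ∀ q t → divℕ q (suc t) *q ℕtoℚ (suc t) ≡ q
divℕ-*-cancel q t
  rewrite ℕtoℚ-mkℚ (suc t) | ℚP.normalize-coprime {1} {t} (1-coprimeTo (suc t)) =
  trans (ℚP.*-assoc q _ _)
        (trans (cong (q *q_) (ℚP.*-inverseˡ (mkℚ (+ suc t) 0 (coprime-sym (1-coprimeTo (suc t))))))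
               (ℚP.*-identityʳ q))

divℕ-unique : ∀ {x q} t → x *q ℕtoℚ (suc t) ≡ q → divℕ q (suc t) ≡ x
divℕ-unique {x} t refl =
  trans (solve 3 (λ a b c → (a :* b) :* c := (a :* c) :* b) refl x (ℕtoℚ (suc t)) (+ 1 Q./ suc t))
        (divℕ-*-cancel x t)

divℕ-distrib-+ : ∀ p q n → divℕ (p +q q) n ≡ divℕ p n +q divℕ q n
divℕ-distrib-+ p q ℕ.zero  = refl
divℕ-distrib-+ p q (suc n) = ℚP.*-distribʳ-+ _ p q

*-cancelˡ-≡ : ∀ r .{{_ : Q.NonZero r}} {p q} → r *q p ≡ r *q q → p ≡ q
*-cancelˡ-≡ r {p} {q} eq = begin
  p                    ≡⟨ sym (ℚP.*-identityˡ p) ⟩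
  1ℚ *q p              ≡⟨ cong (_*q p) (sym (ℚP.*-inverseˡ r)) ⟩
  (1/ r *q r) *q p     ≡⟨ ℚP.*-assoc (1/ r) r p ⟩
  1/ r *q (r *q p)     ≡⟨ cong (1/ r *q_) eq ⟩
  1/ r *q (r *q q)     ≡⟨ sym (ℚP.*-assoc (1/ r) r q) ⟩
  (1/ r *q r) *q q     ≡⟨ cong (_*q q) (ℚP.*-inverseˡ r) ⟩
  1ℚ *q q              ≡⟨ ℚP.*-identityˡ q ⟩
  q                    ∎
  where open ≡-Reasoning

∑ : ∀ {n} → (Fin n → ℚ) → ℚ
∑ = sumℚ

∑-cong : ∀ {n} {f g : Fin n → ℚ} → (∀ i → f i ≡ g i) → ∑ f ≡ ∑ g
∑-cong {ℕ.zero} eq = refl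
∑-cong {suc n}  eq = cong₂ _+q_ (eq zero) (∑-cong (eq ∘ suc))

∑-zero : ∀ n → ∑ {n} (λ _ → 0ℚ) ≡ 0ℚ
∑-zero ℕ.zero  = refl
∑-zero (suc n) = cong (0ℚ +q_) (∑-zero n)

∑-distrib-+ : ∀ {n} (f g : Fin n → ℚ) → ∑ (λ i → f i +q g i) ≡ ∑ f +q ∑ g
∑-distrib-+ {ℕ.zero} f g = refl
∑-distrib-+ {suc n}  f g =
  trans (cong (f zero +q g zero +q_) (∑-distrib-+ (f ∘ suc) (g ∘ suc)))
        (solve 4 (λ a b c d → (a :+ b) :+ (c :+ d) := (a :+ c) :+ (b :+ d)) refl
               (f zero) (g zero) (∑ (f ∘ suc)) (∑ (g ∘ suc)))

∑-distrib-sub : ∀ {n} (f g : Fin n → ℚ) → ∑ (λ i → f i -q g i) ≡ ∑ f -q ∑ g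
∑-distrib-sub {ℕ.zero} f g = refl
∑-distrib-sub {suc n}  f g =
  trans (cong (f zero -q g zero +q_) (∑-distrib-sub (f ∘ suc) (g ∘ suc)))
        (solve 4 (λ a b c d → (a :- b) :+ (c :- d) := (a :+ c) :- (b :+ d)) refl
               (f zero) (g zero) (∑ (f ∘ suc)) (∑ (g ∘ suc)))

*-distribˡ-∑ : ∀ {n} c (f : Fin n → ℚ) → c *q ∑ f ≡ ∑ (λ i → c *q f i)
*-distribˡ-∑ {ℕ.zero} c f = ℚP.*-zeroʳ c
*-distribˡ-∑ {suc n}  c f =
  trans (ℚP.*-distribˡ-+ c (f zero) _) (cong (c *q f zero +q_) (*-distribˡ-∑ c (f ∘ suc)))

*-distribʳ-∑ : ∀ {n} c (f : Fin n → ℚ) → ∑ f *q c ≡ ∑ (λ i → f i *q c)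
*-distribʳ-∑ c f =
  trans (ℚP.*-comm (∑ f) c) (trans (*-distribˡ-∑ c f) (∑-cong (λ i → ℚP.*-comm c (f i))))

∑-comm : ∀ {m n} (f : Fin m → Fin n → ℚ) →
         ∑ (λ i → ∑ (λ j → f i j)) ≡ ∑ (λ j → ∑ (λ i → f i j))
∑-comm {ℕ.zero} {n} f = sym (∑-zero n)
∑-comm {suc m}      f =
  trans (cong (∑ (f zero) +q_) (∑-comm (f ∘ suc)))
        (sym (∑-distrib-+ (f zero) (λ j → ∑ (λ i → f (suc i) j))))

ind : Bool → ℚ
ind b = if b then 1ℚ else 0ℚ

ind-∧ : ∀ x y → ind (x ∧ y) ≡ ind x *q ind y
ind-∧ false y = sym (ℚP.*-zeroˡ (ind y))
ind-∧ true  y = sym (ℚP.*-identityˡ (ind y))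

ind-∨ : ∀ x y → (x ∧ y) ≡ false → ind (x ∨ y) ≡ ind x +q ind y
ind-∨ false y     _ = sym (ℚP.+-identityˡ (ind y))
ind-∨ true  false _ = refl

==-refl : ∀ {n} (a : Fin n) → (a == a) ≡ true
==-refl a with a F.≟ a
... | yes _ = refl
... | no ne = ⊥-elim (ne refl)

==⇒≡ : ∀ {n} {a b : Fin n} → (a == b) ≡ true → a ≡ b
==⇒≡ {a = a} {b} e with a F.≟ b
... | yes p = p

==-sym : ∀ {n} (a b : Fin n) → (a == b) ≡ (b == a)
==-sym a b with a F.≟ b | b F.≟ a
... | yes _    | yes _    = refl
... | no _     | no _     = refl
... | yes refl | no ne    = ⊥-elim (ne refl)
... | no ne    | yes refl = ⊥-elim (ne refl)

δ : ∀ {n} → Fin n → Fin n → ℚ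
δ a i = ind (a == i)

δ-sym : ∀ {n} (a b : Fin n) → δ a b ≡ δ b a
δ-sym a b = cong ind (==-sym a b)

δ-suc : ∀ {n} (a b : Fin n) → δ (suc a) (suc b) ≡ δ a b
δ-suc a b with a F.≟ b
... | yes refl = refl
... | no _     = refl

δ-subst : ∀ {n} (a i : Fin n) (g : Fin n → ℚ) → δ a i *q g i ≡ δ a i *q g a
δ-subst a i g with a F.≟ i
... | yes refl = refl
... | no _     = trans (ℚP.*-zeroˡ (g i)) (sym (ℚP.*-zeroˡ (g a)))

∑-δ : ∀ {n} (a : Fin n) (g : Fin n → ℚ) → ∑ (λ i → δ a i *q g i) ≡ g a
∑-δ {suc n} zero g =
  trans (cong₂ _+q_ (ℚP.*-identityˡ (g zero))
                    (trans (∑-cong (λ i → ℚP.*-zeroˡ (g (suc i)))) (∑-zero n)))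
        (ℚP.+-identityʳ (g zero))
∑-δ {suc n} (suc a) g =
  trans (cong₂ _+q_ (ℚP.*-zeroˡ (g zero))
                    (trans (∑-cong (λ i → cong (_*q g (suc i)) (δ-suc a i))) (∑-δ a (g ∘ suc))))
        (ℚP.+-identityˡ (g (suc a)))

∑-δ-one : ∀ {n} (a : Fin n) → ∑ (δ a) ≡ 1ℚ
∑-δ-one a = trans (∑-cong (λ i → sym (ℚP.*-identityʳ (δ a i)))) (∑-δ a (λ _ → 1ℚ))

_·_ : ∀ {n} → Mat n → (Fin n → ℚ) → Fin n → ℚ
(M · x) i = ∑ (λ j → M i j *q x j)

infixr 20 _·_

⟨_,_⟩ : ∀ {n} → (Fin n → ℚ) → (Fin n → ℚ) → ℚ
⟨ x , y ⟩ = ∑ (λ i → x i *q y i)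

quad : ∀ {n} → Mat n → (Fin n → ℚ) → ℚ
quad X x = ⟨ x , X · x ⟩

·-congʳ : ∀ {n} (M : Mat n) {x y : Fin n → ℚ} → (∀ i → x i ≡ y i) → ∀ i → (M · x) i ≡ (M · y) i
·-congʳ M eq i = ∑-cong (λ j → cong (M i j *q_) (eq j))

·-congˡ : ∀ {n} {M N : Mat n} → (∀ i j → M i j ≡ N i j) → ∀ x i → (M · x) i ≡ (N · x) i
·-congˡ eq x i = ∑-cong (λ j → cong (_*q x j) (eq i j))

⟨⟩-congʳ : ∀ {n} (x : Fin n → ℚ) {y z : Fin n → ℚ} → (∀ i → y i ≡ z i) → ⟨ x , y ⟩ ≡ ⟨ x , z ⟩
⟨⟩-congʳ x eq = ∑-cong (λ i → cong (x i *q_) (eq i))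

⟨⟩-comm : ∀ {n} (x y : Fin n → ℚ) → ⟨ x , y ⟩ ≡ ⟨ y , x ⟩
⟨⟩-comm x y = ∑-cong (λ i → ℚP.*-comm (x i) (y i))

quad-cong : ∀ {n} (X : Mat n) {x y : Fin n → ℚ} → (∀ i → x i ≡ y i) → quad X x ≡ quad X y
quad-cong X eq = ∑-cong (λ i → cong₂ _*q_ (eq i) (·-congʳ X eq i))

quad-zero : ∀ {n} (X : Mat n) → quad X (λ _ → 0ℚ) ≡ 0ℚ
quad-zero {n} X = trans (∑-cong (λ i → ℚP.*-zeroˡ ((X · (λ _ → 0ℚ)) i))) (∑-zero n)

⟨⟩-const-+ : ∀ {n} (x g : Fin n → ℚ) c → ⟨ x , (λ i → c +q g i) ⟩ ≡ ∑ x *q c +q ⟨ x , g ⟩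
⟨⟩-const-+ x g c =
  trans (∑-cong (λ i → ℚP.*-distribˡ-+ (x i) c (g i)))
        (trans (∑-distrib-+ (λ i → x i *q c) (λ i → x i *q g i)) (cong (_+q ⟨ x , g ⟩) (sym (*-distribʳ-∑ c x))))

⟨⟩-shift : ∀ {n} (α φ : Fin n → ℚ) c → ∑ α ≡ 0ℚ → ⟨ α , (λ i → φ i -q c) ⟩ ≡ ⟨ α , φ ⟩
⟨⟩-shift α φ c ∑α≡0 = begin
  ⟨ α , (λ i → φ i -q c) ⟩        ≡⟨ ⟨⟩-congʳ α (λ i → ℚP.+-comm (φ i) (Q.- c)) ⟩
  ⟨ α , (λ i → Q.- c +q φ i) ⟩    ≡⟨ ⟨⟩-const-+ α φ (Q.- c) ⟩
  ∑ α *q Q.- c +q ⟨ α , φ ⟩       ≡⟨ cong (λ s → s *q Q.- c +q ⟨ α , φ ⟩) ∑α≡0 ⟩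
  0ℚ *q Q.- c +q ⟨ α , φ ⟩        ≡⟨ solve 2 (λ c p → con 0ℚ :* c :+ p := p) refl (Q.- c) ⟨ α , φ ⟩ ⟩
  ⟨ α , φ ⟩                       ∎
  where open ≡-Reasoning

⊗-· : ∀ {n} (A B : Mat n) x i → ((A ⊗ B) · x) i ≡ (A · B · x) i
⊗-· A B x i = begin
  ∑ (λ k → ∑ (λ j → A i j *q B j k) *q x k)     ≡⟨ ∑-cong (λ k → *-distribʳ-∑ (x k) (λ j → A i j *q B j k)) ⟩
  ∑ (λ k → ∑ (λ j → (A i j *q B j k) *q x k))   ≡⟨ ∑-comm (λ k j → (A i j *q B j k) *q x k) ⟩
  ∑ (λ j → ∑ (λ k → (A i j *q B j k) *q x k))   ≡⟨ ∑-cong (λ j → ∑-cong (λ k → ℚP.*-assoc (A i j) (B j k) (x k))) ⟩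
  ∑ (λ j → ∑ (λ k → A i j *q (B j k *q x k)))   ≡⟨ ∑-cong (λ j → sym (*-distribˡ-∑ (A i j) (λ k → B j k *q x k))) ⟩
  ∑ (λ j → A i j *q (B · x) j)                  ∎
  where open ≡-Reasoning

⟨·⟩-transpose : ∀ {n} (M : Mat n) x y → ⟨ M · x , y ⟩ ≡ ⟨ x , transpose M · y ⟩
⟨·⟩-transpose M x y = begin
  ∑ (λ i → ∑ (λ j → M i j *q x j) *q y i)     ≡⟨ ∑-cong (λ i → *-distribʳ-∑ (y i) (λ j → M i j *q x j)) ⟩
  ∑ (λ i → ∑ (λ j → (M i j *q x j) *q y i))   ≡⟨ ∑-comm (λ i j → (M i j *q x j) *q y i) ⟩
  ∑ (λ j → ∑ (λ i → (M i j *q x j) *q y i))   ≡⟨ ∑-cong (λ j → ∑-cong (λ i → rearrange (M i j) (x j) (y i))) ⟩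
  ∑ (λ j → ∑ (λ i → x j *q (M i j *q y i)))   ≡⟨ ∑-cong (λ j → sym (*-distribˡ-∑ (x j) (λ i → M i j *q y i))) ⟩
  ⟨ x , transpose M · y ⟩                     ∎
  where
  open ≡-Reasoning
  rearrange : ∀ a b c → (a *q b) *q c ≡ b *q (a *q c)
  rearrange = solve 3 (λ a b c → (a :* b) :* c := b :* (a :* c)) refl

δ-diff : ∀ {n} → Fin n → Fin n → Fin n → ℚ
δ-diff a b i = δ a i -q δ b i

∑-δ-diff : ∀ {n} (a b : Fin n) → ∑ (δ-diff a b) ≡ 0ℚ
∑-δ-diff a b = trans (∑-distrib-sub (δ a) (δ b)) (cong₂ _-q_ (∑-δ-one a) (∑-δ-one b))

⟨δ-diff⟩ : ∀ {n} (a b : Fin n) g → ⟨ δ-diff a b , g ⟩ ≡ g a -q g b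
⟨δ-diff⟩ a b g = begin
  ∑ (λ i → (δ a i -q δ b i) *q g i)               ≡⟨ ∑-cong (λ i → ℚ-ring.[y-z]x≈yx-zx (g i) (δ a i) (δ b i)) ⟩
  ∑ (λ i → δ a i *q g i -q δ b i *q g i)          ≡⟨ ∑-distrib-sub (λ i → δ a i *q g i) (λ i → δ b i *q g i) ⟩
  ∑ (λ i → δ a i *q g i) -q ∑ (λ i → δ b i *q g i) ≡⟨ cong₂ _-q_ (∑-δ a g) (∑-δ b g) ⟩
  g a -q g b                                       ∎
  where open ≡-Reasoning

quad-δ-diff : ∀ {n} (X : Mat n) a b → quad X (δ-diff a b) ≡ resistance X a b
quad-δ-diff X a b = begin
  ⟨ δ-diff a b , X · δ-diff a b ⟩                 ≡⟨ ⟨δ-diff⟩ a b (X · δ-diff a b) ⟩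
  (X · δ-diff a b) a -q (X · δ-diff a b) b       ≡⟨ cong₂ _-q_ (column a) (column b) ⟩
  (X a a -q X a b) -q (X b a -q X b b)           ≡⟨ solve 4 (λ p q r s → (p :- q) :- (r :- s) := ((p :+ s) :- q) :- r) refl
                                                           (X a a) (X a b) (X b a) (X b b) ⟩
  resistance X a b                               ∎
  where
  open ≡-Reasoning
  column : ∀ i → (X · δ-diff a b) i ≡ X i a -q X i b
  column i = trans (⟨⟩-comm (X i) (δ-diff a b)) (⟨δ-diff⟩ a b (X i))

resistance-sym : ∀ {n} (X : Mat n) a b → resistance X a b ≡ resistance X b a
resistance-sym X a b =
  solve 4 (λ p q r s → ((p :+ q) :- r) :- s := ((q :+ p) :- s) :- r) refl (X a a) (X b b) (X a b) (X b a)

Loopless : ∀ {n} → Graph n → Set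
Loopless {n} H = ∀ (i : Fin n) → H i i ≡ false

degℚ : ∀ {n} → Graph n → Fin n → ℚ
degℚ H i = ℕtoℚ (deg H i)

ℕtoℚ-sumℕ : ∀ {n} (f : Fin n → ℕ) → ℕtoℚ (sumℕ f) ≡ ∑ (ℕtoℚ ∘ f)
ℕtoℚ-sumℕ {ℕ.zero} f = refl
ℕtoℚ-sumℕ {suc n}  f = trans (ℕtoℚ-+ (f zero) (sumℕ (f ∘ suc))) (cong (ℕtoℚ (f zero) +q_) (ℕtoℚ-sumℕ (f ∘ suc)))

ℕtoℚ-if : ∀ b → ℕtoℚ (if b then 1 else 0) ≡ ind b
ℕtoℚ-if true  = refl
ℕtoℚ-if false = refl

degℚ-∑ : ∀ {n} (H : Graph n) i → degℚ H i ≡ ∑ (λ j → ind (H i j))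
degℚ-∑ H i = trans (ℕtoℚ-sumℕ (λ j → if H i j then 1 else 0)) (∑-cong (λ j → ℕtoℚ-if (H i j)))

laplacian-entry : ∀ {n} {H : Graph n} → Loopless H → ∀ i j →
                  laplacian H i j ≡ δ i j *q degℚ H i -q ind (H i j)
laplacian-entry {H = H} loopless i j with i F.≟ j | H i j in Hij
... | yes refl | true  with () ← trans (sym Hij) (loopless i)
... | yes refl | false = solve 1 (λ d → d := con 1ℚ :* d :- con 0ℚ) refl (degℚ H i)
... | no _     | true  = solve 1 (λ d → con 0ℚ :- con 1ℚ := con 0ℚ :* d :- con 1ℚ) refl (degℚ H i)
... | no _     | false = solve 1 (λ d → con 0ℚ := con 0ℚ :* d :- con 0ℚ) refl (degℚ H i)

laplacian-sym : ∀ {n} {H : Graph n} → IsSimple H → ∀ i j → laplacian H i j ≡ laplacian H j i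
laplacian-sym {H = H} (symmetric , loopless) i j = begin
  laplacian H i j                    ≡⟨ laplacian-entry loopless i j ⟩
  δ i j *q degℚ H i -q ind (H i j)   ≡⟨ cong₂ (λ u v → u -q ind v) swap-δ (symmetric i j) ⟩
  δ j i *q degℚ H j -q ind (H j i)   ≡⟨ sym (laplacian-entry loopless j i) ⟩
  laplacian H j i                    ∎
  where
  open ≡-Reasoning
  swap-δ : δ i j *q degℚ H i ≡ δ j i *q degℚ H j
  swap-δ = trans (sym (δ-subst i j (degℚ H))) (cong (_*q degℚ H j) (δ-sym i j))

laplacian-· : ∀ {n} {H : Graph n} → Loopless H → ∀ x i →
              (laplacian H · x) i ≡ ∑ (λ j → ind (H i j) *q (x i -q x j))
laplacian-· {H = H} loopless x i = begin
  ∑ (λ j → laplacian H i j *q x j)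
    ≡⟨ ∑-cong (λ j → trans (cong (_*q x j) (laplacian-entry loopless i j)) (expand (δ i j) (degℚ H i) (A j) (x j))) ⟩
  ∑ (λ j → δ i j *q (degℚ H i *q x j) -q A j *q x j)
    ≡⟨ ∑-distrib-sub (λ j → δ i j *q (degℚ H i *q x j)) (λ j → A j *q x j) ⟩
  ∑ (λ j → δ i j *q (degℚ H i *q x j)) -q ∑ (λ j → A j *q x j)
    ≡⟨ cong (_-q ∑ (λ j → A j *q x j)) (trans (∑-δ i (λ j → degℚ H i *q x j)) (cong (_*q x i) (degℚ-∑ H i))) ⟩
  ∑ A *q x i -q ∑ (λ j → A j *q x j)
    ≡⟨ cong (_-q ∑ (λ j → A j *q x j)) (*-distribʳ-∑ (x i) A) ⟩
  ∑ (λ j → A j *q x i) -q ∑ (λ j → A j *q x j)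
    ≡⟨ sym (∑-distrib-sub (λ j → A j *q x i) (λ j → A j *q x j)) ⟩
  ∑ (λ j → A j *q x i -q A j *q x j)
    ≡⟨ ∑-cong (λ j → sym (ℚ-ring.x[y-z]≈xy-xz (A j) (x i) (x j))) ⟩
  ∑ (λ j → A j *q (x i -q x j))
    ∎
  where
  open ≡-Reasoning
  A : Fin _ → ℚ
  A j = ind (H i j)
  expand : ∀ a d h y → (a *q d -q h) *q y ≡ a *q (d *q y) -q h *q y
  expand = solve 4 (λ a d h y → (a :* d :- h) :* y := a :* (d :* y) :- h :* y) refl

laplacian-shift : ∀ {n} {H : Graph n} → Loopless H → ∀ f c i →
                  (laplacian H · (λ j → f j -q c)) i ≡ (laplacian H · f) i
laplacian-shift {H = H} loopless f c i =
  trans (laplacian-· loopless (λ j → f j -q c) i)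
        (trans (∑-cong (λ j → cong (ind (H i j) *q_) (solve 3 (λ x y z → (x :- z) :- (y :- z) := x :- y) refl (f i) (f j) c)))
               (sym (laplacian-· loopless f i)))

edgesℚ-∑ : ∀ {n} (H : Graph n) →
           ℕtoℚ (edges H) ≡ ∑ (λ i → ∑ (λ j → ind (H i j ∧ (toℕ i ℕ.<ᵇ toℕ j))))
edgesℚ-∑ H = trans (ℕtoℚ-sumℕ (λ i → sumℕ (edge i)))
                   (∑-cong (λ i → trans (ℕtoℚ-sumℕ (edge i)) (∑-cong (λ j → ℕtoℚ-if (H i j ∧ (toℕ i ℕ.<ᵇ toℕ j))))))
  where
  edge : _ → _ → ℕ
  edge i j = if H i j ∧ (toℕ i ℕ.<ᵇ toℕ j) then 1 else 0

<ᵇ-true : ∀ {a b} → a ℕ.< b → (a ℕ.<ᵇ b) ≡ true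
<ᵇ-true {a} {b} a<b with a ℕ.<ᵇ b | ℕP.<⇒<ᵇ a<b
... | true | _ = refl

<ᵇ-false : ∀ {a b} → ¬ a ℕ.< b → (a ℕ.<ᵇ b) ≡ false
<ᵇ-false {a} {b} a≮b with a ℕ.<ᵇ b | ℕP.<ᵇ⇒< a b
... | true  | a<b = ⊥-elim (a≮b (a<b _))
... | false | _   = refl

ind-split : ∀ {n} {H : Graph n} → IsSimple H → ∀ i j →
            ind (H i j) ≡ ind (H i j ∧ (toℕ i ℕ.<ᵇ toℕ j)) +q ind (H j i ∧ (toℕ j ℕ.<ᵇ toℕ i))
ind-split {H = H} (symmetric , loopless) i j rewrite symmetric j i with H i j in Hij
... | false = refl
... | true with ℕ.<-cmp (toℕ i) (toℕ j)
...   | tri< i<j _ j≮i rewrite <ᵇ-true i<j | <ᵇ-false j≮i = refl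
...   | tri> i≮j _ j<i rewrite <ᵇ-false i≮j | <ᵇ-true j<i = refl
...   | tri≈ _ i≡j _ with FP.toℕ-injective i≡j
...     | refl with () ← trans (sym Hij) (loopless i)

handshake : ∀ {n} (H : Graph n) → IsSimple H → ∑ (degℚ H) ≡ ℕtoℚ (edges H) +q ℕtoℚ (edges H)
handshake H simple = begin
  ∑ (degℚ H)
    ≡⟨ ∑-cong (λ i → trans (degℚ-∑ H i) (∑-cong (ind-split simple i))) ⟩
  ∑ (λ i → ∑ (λ j → A i j +q A j i))
    ≡⟨ ∑-cong (λ i → ∑-distrib-+ (A i) (λ j → A j i)) ⟩
  ∑ (λ i → ∑ (A i) +q ∑ (λ j → A j i))
    ≡⟨ ∑-distrib-+ (λ i → ∑ (A i)) (λ i → ∑ (λ j → A j i)) ⟩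
  ∑ (λ i → ∑ (A i)) +q ∑ (λ i → ∑ (λ j → A j i))
    ≡⟨ cong (∑ (λ i → ∑ (A i)) +q_) (∑-comm (λ i j → A j i)) ⟩
  ∑ (λ i → ∑ (A i)) +q ∑ (λ i → ∑ (A i))
    ≡⟨ sym (cong₂ _+q_ (edgesℚ-∑ H) (edgesℚ-∑ H)) ⟩
  ℕtoℚ (edges H) +q ℕtoℚ (edges H)
    ∎
  where
  open ≡-Reasoning
  A : _ → _ → ℚ
  A i j = ind (H i j ∧ (toℕ i ℕ.<ᵇ toℕ j))

edges-from-degree-sum : ∀ {n} {H : Graph n} N → IsSimple H →
                        ∑ (degℚ H) ≡ ℕtoℚ N +q ℕtoℚ N → edges H ≡ N
edges-from-degree-sum {H = H} N simple degree-sum =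
  ℕtoℚ-injective (*-cancelˡ-≡ (ℕtoℚ 2) (begin
    ℕtoℚ 2 *q ℕtoℚ (edges H)             ≡⟨ double (ℕtoℚ (edges H)) ⟩
    ℕtoℚ (edges H) +q ℕtoℚ (edges H)     ≡⟨ trans (sym (handshake H simple)) degree-sum ⟩
    ℕtoℚ N +q ℕtoℚ N                     ≡⟨ sym (double (ℕtoℚ N)) ⟩
    ℕtoℚ 2 *q ℕtoℚ N                     ∎))
  where
  open ≡-Reasoning
  double : ∀ x → ℕtoℚ 2 *q x ≡ x +q x
  double = solve 1 (λ x → con (ℕtoℚ 2) :* x := x :+ x) refl

p≤q⇒0≤q-p : ∀ {p q} → p ≤q q → 0ℚ ≤q q -q p
p≤q⇒0≤q-p {p} {q} p≤q = subst (_≤q q -q p) (ℚP.+-inverseʳ p) (ℚP.+-monoˡ-≤ (Q.- p) p≤q)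

∑-nonneg : ∀ {n} (f : Fin n → ℚ) → (∀ i → 0ℚ ≤q f i) → 0ℚ ≤q ∑ f
∑-nonneg {ℕ.zero} f nonneg = ℚP.≤-refl
∑-nonneg {suc n}  f nonneg = ℚP.+-mono-≤ (nonneg zero) (∑-nonneg (f ∘ suc) (nonneg ∘ suc))

nonneg+nonneg≡0 : ∀ {a b} → 0ℚ ≤q a → 0ℚ ≤q b → a +q b ≡ 0ℚ → a ≡ 0ℚ
nonneg+nonneg≡0 {a} {b} 0≤a 0≤b a+b≡0 = ℚP.≤-antisym a≤0 0≤a
  where
  a≤0 : a ≤q 0ℚ
  a≤0 = subst₂ _≤q_ (ℚP.+-identityʳ a) a+b≡0 (ℚP.+-monoʳ-≤ a 0≤b)

nonneg-∑≡0 : ∀ {n} (f : Fin n → ℚ) → (∀ i → 0ℚ ≤q f i) → ∑ f ≡ 0ℚ → ∀ i → f i ≡ 0ℚ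
nonneg-∑≡0 {suc n} f nonneg ∑f≡0 zero =
  nonneg+nonneg≡0 (nonneg zero) (∑-nonneg (f ∘ suc) (nonneg ∘ suc)) ∑f≡0
nonneg-∑≡0 {suc n} f nonneg ∑f≡0 (suc i) =
  nonneg-∑≡0 (f ∘ suc) (nonneg ∘ suc)
    (nonneg+nonneg≡0 (∑-nonneg (f ∘ suc) (nonneg ∘ suc)) (nonneg zero) (trans (ℚP.+-comm _ (f zero)) ∑f≡0)) i

argmax : ∀ {n} (y : Fin (suc n) → ℚ) → ∃ λ i → ∀ j → y j ≤q y i
argmax {ℕ.zero} y = zero , λ { zero → ℚP.≤-refl }
argmax {suc n}  y with argmax (y ∘ suc)
... | i , maximal with ℚP.≤-total (y zero) (y (suc i))
... | inj₁ y₀≤ = suc i , λ { zero → y₀≤ ; (suc j) → maximal j }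
... | inj₂ ≤y₀ = zero  , λ { zero → ℚP.≤-refl ; (suc j) → ℚP.≤-trans (maximal j) ≤y₀ }

module _ {n} {H : Graph n} (loopless : Loopless H) (y : Fin n → ℚ)
         (harmonic : ∀ i → (laplacian H · y) i ≡ 0ℚ) where

  -- At a maximum i, (L y)ᵢ = Σⱼ [i ~ j] (yᵢ - yⱼ) is a vanishing sum of nonnegative terms.
  maximum-neighbour : ∀ {i k} → (∀ j → y j ≤q y i) → H i k ≡ true → y k ≡ y i
  maximum-neighbour {i} {k} maximal i~k = sym (ℚ-group.x∙y⁻¹≈ε⇒x≈y (y i) (y k) yᵢ-yₖ≡0)
    where
    term : Fin n → ℚ
    term j = ind (H i j) *q (y i -q y j)
    term-nonneg : ∀ j → 0ℚ ≤q term j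
    term-nonneg j with H i j
    ... | true  = subst (0ℚ ≤q_) (sym (ℚP.*-identityˡ (y i -q y j))) (p≤q⇒0≤q-p (maximal j))
    ... | false = subst (0ℚ ≤q_) (sym (ℚP.*-zeroˡ (y i -q y j))) ℚP.≤-refl
    yᵢ-yₖ≡0 : y i -q y k ≡ 0ℚ
    yᵢ-yₖ≡0 = trans (sym (ℚP.*-identityˡ (y i -q y k)))
                (subst (λ b → ind b *q (y i -q y k) ≡ 0ℚ) i~k
                  (nonneg-∑≡0 term term-nonneg (trans (sym (laplacian-· loopless y i)) (harmonic i)) k))

  maximum-spreads : ∀ {i j} → (∀ j → y j ≤q y i) → Reach H i j → y j ≡ y i
  maximum-spreads maximal here = refl
  maximum-spreads maximal (step i~k k⇝j) =
    trans (maximum-spreads (λ j → subst (y j ≤q_) (sym yₖ≡yᵢ) (maximal j)) k⇝j) yₖ≡yᵢ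
    where yₖ≡yᵢ = maximum-neighbour maximal i~k

harmonic-constant : ∀ {n} {H : Graph n} → Loopless H → Connected H → (y : Fin n → ℚ) →
                    (∀ i → (laplacian H · y) i ≡ 0ℚ) → ∀ i j → y i ≡ y j
harmonic-constant {suc n} loopless connected y harmonic i j with argmax y
... | top , maximal =
  trans (maximum-spreads loopless y harmonic maximal (connected top i))
        (sym (maximum-spreads loopless y harmonic maximal (connected top j)))

-- Only the first Penrose equation L X L = L enters the argument.
IsGeneralizedInverse : ∀ {n} → Mat n → Mat n → Set
IsGeneralizedInverse {n} L X = ∀ (i j : Fin n) → ((L ⊗ X) ⊗ L) i j ≡ L i j

pseudoInverse⇒generalizedInverse : ∀ {n} {L X : Mat n} → IsPseudoInverse L X → IsGeneralizedInverse L X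
pseudoInverse⇒generalizedInverse (LXL≡L , _) i j = cong-app (cong-app LXL≡L i) j

-- Rows of I - L X are harmonic, hence constant, so I - L X kills every α with Σ α = 0.
laplacian-generalizedInverse : ∀ {n} {H : Graph n} {X : Mat n} → IsSimple H → Connected H →
                               IsGeneralizedInverse (laplacian H) X →
                               ∀ α → ∑ α ≡ 0ℚ → ∀ i → (laplacian H · X · α) i ≡ α i
laplacian-generalizedInverse {H = H} {X} simple connected ginv α ∑α≡0 i = begin
  (L · X · α) i                                 ≡⟨ sym (⊗-· L X α i) ⟩
  ∑ (λ j → (L ⊗ X) i j *q α j)                  ≡⟨ ∑-cong (λ j → cong (_*q α j) (solve 2 (λ p d → p := d :- (d :- p)) refl ((L ⊗ X) i j) (δ i j))) ⟩
  ∑ (λ j → (δ i j -q Q i j) *q α j)             ≡⟨ ∑-cong (λ j → ℚ-ring.[y-z]x≈yx-zx (α j) (δ i j) (Q i j)) ⟩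
  ∑ (λ j → δ i j *q α j -q Q i j *q α j)        ≡⟨ ∑-distrib-sub (λ j → δ i j *q α j) (λ j → Q i j *q α j) ⟩
  ∑ (λ j → δ i j *q α j) -q ∑ (λ j → Q i j *q α j)
    ≡⟨ cong₂ _-q_ (∑-δ i α) (trans (∑-cong (λ j → cong (_*q α j) (Q-row-constant j))) (sym (*-distribˡ-∑ (Q i i) α))) ⟩
  α i -q Q i i *q ∑ α                           ≡⟨ cong (λ s → α i -q Q i i *q s) ∑α≡0 ⟩
  α i -q Q i i *q 0ℚ                            ≡⟨ solve 2 (λ a q → a :- q :* con 0ℚ := a) refl (α i) (Q i i) ⟩
  α i                                           ∎
  where
  open ≡-Reasoning
  L = laplacian H
  Q : Mat _
  Q a b = δ a b -q (L ⊗ X) a b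
  Q-harmonic : ∀ k → (L · Q i) k ≡ 0ℚ
  Q-harmonic k = begin
    ∑ (λ j → L k j *q Q i j)                                  ≡⟨ ∑-cong (λ j → trans (cong (_*q Q i j) (laplacian-sym simple k j)) (ℚP.*-comm (L j k) (Q i j))) ⟩
    ∑ (λ j → (δ i j -q (L ⊗ X) i j) *q L j k)                 ≡⟨ ∑-cong (λ j → ℚ-ring.[y-z]x≈yx-zx (L j k) (δ i j) ((L ⊗ X) i j)) ⟩
    ∑ (λ j → δ i j *q L j k -q (L ⊗ X) i j *q L j k)          ≡⟨ ∑-distrib-sub (λ j → δ i j *q L j k) (λ j → (L ⊗ X) i j *q L j k) ⟩
    ∑ (λ j → δ i j *q L j k) -q ((L ⊗ X) ⊗ L) i k             ≡⟨ cong₂ _-q_ (∑-δ i (λ j → L j k)) (ginv i k) ⟩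
    L i k -q L i k                                            ≡⟨ ℚP.+-inverseʳ (L i k) ⟩
    0ℚ                                                        ∎
  Q-row-constant : ∀ j → Q i j ≡ Q i i
  Q-row-constant j = harmonic-constant (proj₂ simple) connected (Q i) Q-harmonic j i

quad-generalizedInverse : ∀ {n} {L X : Mat n} → (∀ i j → L i j ≡ L j i) → IsGeneralizedInverse L X →
                          ∀ x → quad X (L · x) ≡ ⟨ x , L · x ⟩
quad-generalizedInverse {L = L} {X} L-sym ginv x = begin
  ⟨ L · x , X · L · x ⟩                     ≡⟨ ⟨·⟩-transpose L x (X · L · x) ⟩
  ⟨ x , transpose L · X · L · x ⟩           ≡⟨ ⟨⟩-congʳ x (·-congˡ (λ i j → L-sym j i) (X · L · x)) ⟩
  ⟨ x , L · X · L · x ⟩                     ≡⟨ ⟨⟩-congʳ x (λ i → sym (trans (⊗-· (L ⊗ X) L x i) (⊗-· L X (L · x) i))) ⟩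
  ⟨ x , ((L ⊗ X) ⊗ L) · x ⟩                  ≡⟨ ⟨⟩-congʳ x (·-congˡ ginv x) ⟩
  ⟨ x , L · x ⟩                             ∎
  where open ≡-Reasoning

true≢false : true ≢ false
true≢false ()

∨-elim : ∀ {x y} → (x ∨ y) ≡ true → x ≡ true ⊎ y ≡ true
∨-elim {true}  _ = inj₁ refl
∨-elim {false} e = inj₂ e

∧-elim : ∀ {x y} → (x ∧ y) ≡ true → x ≡ true × y ≡ true
∧-elim {true} {true} _ = refl , refl

∨-introˡ : ∀ {x} y → x ≡ true → (x ∨ y) ≡ true
∨-introˡ y refl = refl

∨-introʳ : ∀ x {y} → y ≡ true → (x ∨ y) ≡ true
∨-introʳ true  _ = refl
∨-introʳ false e = e

∧-intro : ∀ {x y} → x ≡ true → y ≡ true → (x ∧ y) ≡ true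
∧-intro refl refl = refl

≢true⇒≡false : ∀ {x} → (x ≡ true → ⊥) → x ≡ false
≢true⇒≡false {true}  x≢true = ⊥-elim (x≢true refl)
≢true⇒≡false {false} _      = refl

true-ext : ∀ {x y} → (x ≡ true → y ≡ true) → (y ≡ true → x ≡ true) → x ≡ y
true-ext {true}  {true}  _ _ = refl
true-ext {true}  {false} x⇒y _ = sym (x⇒y refl)
true-ext {false} {true}  _ y⇒x = y⇒x refl
true-ext {false} {false} _ _ = refl

anyFin-intro : ∀ {n} (f : Fin n → Bool) a → f a ≡ true → anyFin f ≡ true
anyFin-intro f zero    fa = ∨-introˡ (anyFin (f ∘ suc)) fa
anyFin-intro f (suc a) fa = ∨-introʳ (f zero) (anyFin-intro (f ∘ suc) a fa)

anyFin-elim : ∀ {n} (f : Fin n → Bool) → anyFin f ≡ true → ∃ λ a → f a ≡ true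
anyFin-elim {suc n} f any with ∨-elim {f zero} any
... | inj₁ f₀ = zero , f₀
... | inj₂ any′ with anyFin-elim (f ∘ suc) any′
...   | a , fa = suc a , fa

ind-anyFin : ∀ {n} (f : Fin n → Bool) → (∀ a b → f a ≡ true → f b ≡ true → a ≡ b) →
             ind (anyFin f) ≡ ∑ (ind ∘ f)
ind-anyFin {ℕ.zero} f unique = refl
ind-anyFin {suc n}  f unique =
  trans (ind-∨ (f zero) (anyFin (f ∘ suc)) disjoint)
        (cong (ind (f zero) +q_) (ind-anyFin (f ∘ suc) (λ a b fa fb → FP.suc-injective (unique (suc a) (suc b) fa fb))))
  where
  disjoint : (f zero ∧ anyFin (f ∘ suc)) ≡ false
  disjoint = ≢true⇒≡false λ both → let (f₀ , any′) = ∧-elim {f zero} both; (a , fa) = anyFin-elim (f ∘ suc) any′ in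
    zero≢suc (unique zero (suc a) f₀ fa)
    where
    zero≢suc : ∀ {m} {a : Fin m} → zero ≢ suc a
    zero≢suc ()

-- oneSum G₁ v₁ G₂ v₂ I J unfolds to imageGraph (emb₁ k) G₁ I J ∨ imageGraph (emb₂ v₁ v₂) G₂ I J.
imageGraph : ∀ {m N} → (Fin m → Fin N) → Graph m → Graph N
imageGraph e G I J = anyFin (λ a → anyFin (λ b → G a b ∧ (e a == I) ∧ (e b == J)))

imageGraph-intro : ∀ {m N} (e : Fin m → Fin N) {G : Graph m} a b → G a b ≡ true →
                   imageGraph e G (e a) (e b) ≡ true
imageGraph-intro e a b Gab =
  anyFin-intro _ a (anyFin-intro _ b (∧-intro Gab (∧-intro (==-refl (e a)) (==-refl (e b)))))

imageGraph-elim : ∀ {m N} (e : Fin m → Fin N) {G : Graph m} I J → imageGraph e G I J ≡ true →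
                  ∃ λ a → ∃ λ b → G a b ≡ true × e a ≡ I × e b ≡ J
imageGraph-elim e {G} I J edge with anyFin-elim _ edge
... | a , edgeₐ with anyFin-elim _ edgeₐ
...   | b , edgeₐᵦ with ∧-elim {G a b} edgeₐᵦ
...     | Gab , ends with ∧-elim {e a == I} ends
...       | eaI , ebJ = a , b , Gab , ==⇒≡ eaI , ==⇒≡ ebJ

push : ∀ {m N} → (Fin m → Fin N) → (Fin m → ℚ) → Fin N → ℚ
push e α I = ∑ (λ a → δ (e a) I *q α a)

⟨push⟩ : ∀ {m N} (e : Fin m → Fin N) α h → ⟨ push e α , h ⟩ ≡ ⟨ α , h ∘ e ⟩
⟨push⟩ e α h = begin
  ∑ (λ I → ∑ (λ a → δ (e a) I *q α a) *q h I)     ≡⟨ ∑-cong (λ I → *-distribʳ-∑ (h I) (λ a → δ (e a) I *q α a)) ⟩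
  ∑ (λ I → ∑ (λ a → (δ (e a) I *q α a) *q h I))   ≡⟨ ∑-comm (λ I a → (δ (e a) I *q α a) *q h I) ⟩
  ∑ (λ a → ∑ (λ I → (δ (e a) I *q α a) *q h I))   ≡⟨ ∑-cong (λ a → ∑-cong (λ I → ℚP.*-assoc (δ (e a) I) (α a) (h I))) ⟩
  ∑ (λ a → ∑ (λ I → δ (e a) I *q (α a *q h I)))   ≡⟨ ∑-cong (λ a → ∑-δ (e a) (λ I → α a *q h I)) ⟩
  ⟨ α , h ∘ e ⟩                                   ∎
  where open ≡-Reasoning

push-δ-diff : ∀ {m N} (e : Fin m → Fin N) a b I → push e (δ-diff a b) I ≡ δ-diff (e a) (e b) I
push-δ-diff e a b I = trans (⟨⟩-comm (λ c → δ (e c) I) (δ-diff a b)) (⟨δ-diff⟩ a b (λ c → δ (e c) I))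

push-zero : ∀ {m N} (e : Fin m → Fin N) I → push e (λ _ → 0ℚ) I ≡ 0ℚ
push-zero {m} e I = trans (∑-cong (λ c → ℚP.*-zeroʳ (δ (e c) I))) (∑-zero m)

push-cong : ∀ {m N} (e : Fin m → Fin N) {α β : Fin m → ℚ} → (∀ a → α a ≡ β a) → ∀ I → push e α I ≡ push e β I
push-cong e eq I = ∑-cong (λ a → cong (δ (e a) I *q_) (eq a))

⟨⟩-distribˡ-+ : ∀ {n} (x y h : Fin n → ℚ) → ⟨ (λ i → x i +q y i) , h ⟩ ≡ ⟨ x , h ⟩ +q ⟨ y , h ⟩
⟨⟩-distribˡ-+ x y h = trans (∑-cong (λ i → ℚP.*-distribʳ-+ (h i) (x i) (y i))) (∑-distrib-+ (λ i → x i *q h i) (λ i → y i *q h i))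

⟨⟩-oneʳ : ∀ {n} (x : Fin n → ℚ) → ⟨ x , (λ _ → 1ℚ) ⟩ ≡ ∑ x
⟨⟩-oneʳ x = ∑-cong (λ i → ℚP.*-identityʳ (x i))

module _ {m N} {e : Fin m → Fin N} (e-injective : Injective _≡_ _≡_ e) (G : Graph m) where

  ind-imageGraph : ∀ I J → ind (imageGraph e G I J) ≡ ∑ (λ a → ∑ (λ b → ind (G a b) *q (δ (e a) I *q δ (e b) J)))
  ind-imageGraph I J =
    trans (ind-anyFin _ source-unique)
          (∑-cong (λ a → trans (ind-anyFin _ (target-unique a))
                               (∑-cong (λ b → trans (ind-∧ (G a b) _) (cong (ind (G a b) *q_) (ind-∧ (e a == I) (e b == J)))))))
    where
    edge : Fin m → Fin m → Bool
    edge a b = G a b ∧ (e a == I) ∧ (e b == J)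
    source : ∀ {a b} → edge a b ≡ true → e a ≡ I
    source {a} {b} h = ==⇒≡ (proj₁ (∧-elim {e a == I} (proj₂ (∧-elim {G a b} h))))
    target : ∀ {a b} → edge a b ≡ true → e b ≡ J
    target {a} {b} h = ==⇒≡ (proj₂ (∧-elim {e a == I} (proj₂ (∧-elim {G a b} h))))
    source-unique : ∀ a a′ → anyFin (edge a) ≡ true → anyFin (edge a′) ≡ true → a ≡ a′
    source-unique a a′ h h′ with anyFin-elim (edge a) h | anyFin-elim (edge a′) h′
    ... | _ , hb | _ , hb′ = e-injective (trans (source hb) (sym (source hb′)))
    target-unique : ∀ a b b′ → edge a b ≡ true → edge a b′ ≡ true → b ≡ b′
    target-unique a b b′ h h′ = e-injective (trans (target h) (sym (target h′)))

  imageGraph-loopless : Loopless G → Loopless (imageGraph e G)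
  imageGraph-loopless loopless I = ≢true⇒≡false λ loop → no-loop (imageGraph-elim e I I loop)
    where
    no-loop : (∃ λ a → ∃ λ b → G a b ≡ true × e a ≡ I × e b ≡ I) → ⊥
    no-loop (a , b , Gab , refl , eb≡ea) with e-injective eb≡ea
    ... | refl with () ← trans (sym Gab) (loopless a)

  ∑-ind-imageGraph : ∀ I (g : Fin N → ℚ) → ∑ (λ J → ind (imageGraph e G I J) *q g J) ≡ push e (λ a → ∑ (λ b → ind (G a b) *q g (e b))) I
  ∑-ind-imageGraph I g = begin
    ∑ (λ J → ind (imageGraph e G I J) *q g J)
      ≡⟨ ∑-cong (λ J → trans (cong (_*q g J) (ind-imageGraph I J))
                             (trans (*-distribʳ-∑ (g J) (λ a → ∑ (λ b → T a b J))) (∑-cong (λ a → *-distribʳ-∑ (g J) (λ b → T a b J))))) ⟩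
    ∑ (λ J → ∑ (λ a → ∑ (λ b → T a b J *q g J)))
      ≡⟨ ∑-comm (λ J a → ∑ (λ b → T a b J *q g J)) ⟩
    ∑ (λ a → ∑ (λ J → ∑ (λ b → T a b J *q g J)))
      ≡⟨ ∑-cong (λ a → ∑-comm (λ J b → T a b J *q g J)) ⟩
    ∑ (λ a → ∑ (λ b → ∑ (λ J → T a b J *q g J)))
      ≡⟨ ∑-cong (λ a → ∑-cong (λ b → sift a b)) ⟩
    ∑ (λ a → ∑ (λ b → δ (e a) I *q (ind (G a b) *q g (e b))))
      ≡⟨ ∑-cong (λ a → sym (*-distribˡ-∑ (δ (e a) I) (λ b → ind (G a b) *q g (e b)))) ⟩
    push e (λ a → ∑ (λ b → ind (G a b) *q g (e b))) I
      ∎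
    where
    open ≡-Reasoning
    T : Fin m → Fin m → Fin N → ℚ
    T a b J = ind (G a b) *q (δ (e a) I *q δ (e b) J)
    sift : ∀ a b → ∑ (λ J → T a b J *q g J) ≡ δ (e a) I *q (ind (G a b) *q g (e b))
    sift a b = trans (∑-cong (λ J → solve 4 (λ x y z w → (x :* (y :* z)) :* w := z :* (y :* (x :* w))) refl
                                            (ind (G a b)) (δ (e a) I) (δ (e b) J) (g J)))
                     (∑-δ (e b) (λ J → δ (e a) I *q (ind (G a b) *q g J)))

imageGraph-symmetric : ∀ {m N} (e : Fin m → Fin N) {G : Graph m} → (∀ a b → G a b ≡ G b a) →
                       ∀ I J → imageGraph e G I J ≡ imageGraph e G J I
imageGraph-symmetric e {G} symmetric I J = true-ext (flip I J) (flip J I)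
  where
  flip : ∀ I J → imageGraph e G I J ≡ true → imageGraph e G J I ≡ true
  flip I J edge with imageGraph-elim e I J edge
  ... | a , b , Gab , refl , refl = imageGraph-intro e {G} b a (trans (symmetric b a) Gab)

Joins : ∀ {n} → Fin n × Fin n → Fin n → Fin n → Set
Joins p i j = (proj₁ p ≡ i × proj₂ p ≡ j) ⊎ (proj₁ p ≡ j × proj₂ p ≡ i)

joins : ∀ {n} → Fin n × Fin n → Fin n → Fin n → Bool
joins p i j = ((proj₁ p == i) ∧ (proj₂ p == j)) ∨ ((proj₁ p == j) ∧ (proj₂ p == i))

-- addEdges G 𝓛 i j unfolds to G i j ∨ added 𝓛 i j, and added (p ∷ 𝓛) i j to joins p i j ∨ added 𝓛 i j.
added : ∀ {n} → List (Fin n × Fin n) → Graph n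
added 𝓛 = addEdges (λ _ _ → false) 𝓛

Joins-sym : ∀ {n} {p : Fin n × Fin n} {i j} → Joins p i j → Joins p j i
Joins-sym (inj₁ ends) = inj₂ ends
Joins-sym (inj₂ ends) = inj₁ ends

Joins⇒SamePair : ∀ {n} {p q : Fin n × Fin n} {i j} → Joins p i j → Joins q i j → SamePair p q
Joins⇒SamePair (inj₁ (refl , refl)) (inj₁ (refl , refl)) = inj₁ (refl , refl)
Joins⇒SamePair (inj₁ (refl , refl)) (inj₂ (refl , refl)) = inj₂ (refl , refl)
Joins⇒SamePair (inj₂ (refl , refl)) (inj₁ (refl , refl)) = inj₂ (refl , refl)
Joins⇒SamePair (inj₂ (refl , refl)) (inj₂ (refl , refl)) = inj₁ (refl , refl)

joins-elim : ∀ {n} (p : Fin n × Fin n) i j → joins p i j ≡ true → Joins p i j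
joins-elim p i j e with ∨-elim {(proj₁ p == i) ∧ (proj₂ p == j)} e
... | inj₁ e′ = let (a , b) = ∧-elim {proj₁ p == i} e′ in inj₁ (==⇒≡ a , ==⇒≡ b)
... | inj₂ e′ = let (a , b) = ∧-elim {proj₁ p == j} e′ in inj₂ (==⇒≡ a , ==⇒≡ b)

joins-intro : ∀ {n} (p : Fin n × Fin n) i j → Joins p i j → joins p i j ≡ true
joins-intro p i j (inj₁ (refl , refl)) = ∨-introˡ _ (∧-intro (==-refl (proj₁ p)) (==-refl (proj₂ p)))
joins-intro p i j (inj₂ (refl , refl)) = ∨-introʳ ((proj₁ p == proj₂ p) ∧ (proj₂ p == proj₁ p)) (∧-intro (==-refl (proj₁ p)) (==-refl (proj₂ p)))

added-elim : ∀ {n} (𝓛 : List (Fin n × Fin n)) i j → added 𝓛 i j ≡ true → Any (λ p → Joins p i j) 𝓛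
added-elim (p ∷ 𝓛) i j e with ∨-elim {joins p i j} e
... | inj₁ e′ = here (joins-elim p i j e′)
... | inj₂ e′ = there (added-elim 𝓛 i j e′)

added-intro : ∀ {n} (𝓛 : List (Fin n × Fin n)) i j → Any (λ p → Joins p i j) 𝓛 → added 𝓛 i j ≡ true
added-intro (p ∷ 𝓛) i j (here pij)  = ∨-introˡ (added 𝓛 i j) (joins-intro p i j pij)
added-intro (p ∷ 𝓛) i j (there any) = ∨-introʳ (joins p i j) (added-intro 𝓛 i j any)

added-sym : ∀ {n} (𝓛 : List (Fin n × Fin n)) i j → added 𝓛 i j ≡ added 𝓛 j i
added-sym 𝓛 i j = true-ext (flip i j) (flip j i)
  where
  flip : ∀ i j → added 𝓛 i j ≡ true → added 𝓛 j i ≡ true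
  flip i j e = added-intro 𝓛 j i (Any.map Joins-sym (added-elim 𝓛 i j e))

added-loopless : ∀ {n} {𝓛 : List (Fin n × Fin n)} → All (λ p → proj₁ p ≢ proj₂ p) 𝓛 → Loopless (added 𝓛)
added-loopless {𝓛 = 𝓛} distinct i = ≢true⇒≡false λ loop →
  let (p₁≢p₂ , pii) = All.lookupAny distinct (added-elim 𝓛 i i loop) in p₁≢p₂ (ends-equal pii)
  where
  ends-equal : ∀ {p} → Joins p i i → proj₁ p ≡ proj₂ p
  ends-equal (inj₁ (refl , refl)) = refl
  ends-equal (inj₂ (refl , refl)) = refl

ind-joins : ∀ {n} (p : Fin n × Fin n) → proj₁ p ≢ proj₂ p → ∀ i j →
            ind (joins p i j) ≡ δ (proj₁ p) i *q δ (proj₂ p) j +q δ (proj₁ p) j *q δ (proj₂ p) i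
ind-joins p p₁≢p₂ i j =
  trans (ind-∨ ((proj₁ p == i) ∧ (proj₂ p == j)) ((proj₁ p == j) ∧ (proj₂ p == i)) disjoint)
        (cong₂ _+q_ (ind-∧ (proj₁ p == i) (proj₂ p == j)) (ind-∧ (proj₁ p == j) (proj₂ p == i)))
  where
  disjoint : (((proj₁ p == i) ∧ (proj₂ p == j)) ∧ ((proj₁ p == j) ∧ (proj₂ p == i))) ≡ false
  disjoint = ≢true⇒≡false λ both →
    let (forward , backward) = ∧-elim {(proj₁ p == i) ∧ (proj₂ p == j)} both
        (p₁≡i , _) = ∧-elim {proj₁ p == i} forward
        (_ , p₂≡i) = ∧-elim {proj₁ p == j} backward
    in  p₁≢p₂ (trans (==⇒≡ p₁≡i) (sym (==⇒≡ p₂≡i)))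

∑∑-ind-joins : ∀ {n} (p : Fin n × Fin n) → proj₁ p ≢ proj₂ p →
               ∑ (λ i → ∑ (λ j → ind (joins p i j))) ≡ 1ℚ +q 1ℚ
∑∑-ind-joins p p₁≢p₂ = begin
  ∑ (λ i → ∑ (λ j → ind (joins p i j)))
    ≡⟨ ∑-cong (λ i → trans (∑-cong (ind-joins p p₁≢p₂ i)) (∑-distrib-+ (λ j → a i *q b j) (λ j → a j *q b i))) ⟩
  ∑ (λ i → ∑ (λ j → a i *q b j) +q ∑ (λ j → a j *q b i))
    ≡⟨ ∑-distrib-+ (λ i → ∑ (λ j → a i *q b j)) (λ i → ∑ (λ j → a j *q b i)) ⟩
  ∑ (λ i → ∑ (λ j → a i *q b j)) +q ∑ (λ i → ∑ (λ j → a j *q b i))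
    ≡⟨ cong₂ _+q_ (∑∑-δδ (proj₁ p) (proj₂ p))
                  (trans (∑-cong (λ i → ∑-cong (λ j → ℚP.*-comm (a j) (b i)))) (∑∑-δδ (proj₂ p) (proj₁ p))) ⟩
  1ℚ +q 1ℚ
    ∎
  where
  open ≡-Reasoning
  a = δ (proj₁ p)
  b = δ (proj₂ p)
  ∑∑-δδ : ∀ c d → ∑ (λ i → ∑ (λ j → δ c i *q δ d j)) ≡ 1ℚ
  ∑∑-δδ c d = trans (∑-cong (λ i → trans (sym (*-distribˡ-∑ (δ c i) (δ d))) (cong (δ c i *q_) (∑-δ-one d))))
                    (trans (∑-cong (λ i → ℚP.*-identityʳ (δ c i))) (∑-δ-one c))

addEdges-simple : ∀ {n} {G : Graph n} {𝓛} → IsSimple G → All (λ p → proj₁ p ≢ proj₂ p) 𝓛 → IsSimple (addEdges G 𝓛)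
addEdges-simple {𝓛 = 𝓛} (symmetric , loopless) distinct =
  (λ i j → cong₂ _∨_ (symmetric i j) (added-sym 𝓛 i j)) ,
  (λ i → cong₂ _∨_ (loopless i) (added-loopless distinct i))

reach-mono : ∀ {n} {G G′ : Graph n} → (∀ i j → G i j ≡ true → G′ i j ≡ true) → ∀ {i j} → Reach G i j → Reach G′ i j
reach-mono G⊆G′ here             = here
reach-mono G⊆G′ (step i~k k⇝j) = step (G⊆G′ _ _ i~k) (reach-mono G⊆G′ k⇝j)

addEdges-connected : ∀ {n} {G : Graph n} 𝓛 → Connected G → Connected (addEdges G 𝓛)
addEdges-connected {G = G} 𝓛 connected i j = reach-mono (λ a b → ∨-introˡ (added 𝓛 a b)) (connected i j)

ind-addEdges-∷ : ∀ {n} {G : Graph n} {p 𝓛} → (∀ i j → G i j ≡ G j i) → G (proj₁ p) (proj₂ p) ≡ false →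
                 All (λ q → ¬ SamePair p q) 𝓛 → ∀ i j →
                 ind (addEdges G (p ∷ 𝓛) i j) ≡ ind (addEdges G 𝓛 i j) +q ind (joins p i j)
ind-addEdges-∷ {G = G} {p} {𝓛} symmetric nonEdge fresh i j =
  trans (cong ind (reorder (G i j) (joins p i j) (added 𝓛 i j)))
        (ind-∨ (addEdges G 𝓛 i j) (joins p i j) disjoint)
  where
  reorder : ∀ x y z → (x ∨ (y ∨ z)) ≡ ((x ∨ z) ∨ y)
  reorder true  y z = refl
  reorder false y z = BoolP.∨-comm y z
  edge-of : Joins p i j → G i j ≡ G (proj₁ p) (proj₂ p)
  edge-of (inj₁ (refl , refl)) = refl
  edge-of (inj₂ (refl , refl)) = symmetric (proj₂ p) (proj₁ p)
  disjoint : (addEdges G 𝓛 i j ∧ joins p i j) ≡ false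
  disjoint = ≢true⇒≡false λ both →
    let (old , new) = ∧-elim {addEdges G 𝓛 i j} both
        pij = joins-elim p i j new
    in  [ (λ Gij → true≢false (trans (sym Gij) (trans (edge-of pij) nonEdge)))
        , (λ addedij → let (p≉q , qij) = All.lookupAny fresh (added-elim 𝓛 i j addedij) in p≉q (Joins⇒SamePair pij qij))
        ]′ (∨-elim old)

degree-sum-addEdges : ∀ {n} {G : Graph n} {𝓛} → (∀ i j → G i j ≡ G j i) →
                      All (λ p → proj₁ p ≢ proj₂ p) 𝓛 → All (λ p → G (proj₁ p) (proj₂ p) ≡ false) 𝓛 →
                      AllPairs (λ p q → ¬ SamePair p q) 𝓛 →
                      ∑ (degℚ (addEdges G 𝓛)) ≡ ∑ (degℚ G) +q (ℕtoℚ (length 𝓛) +q ℕtoℚ (length 𝓛))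
degree-sum-addEdges {G = G} {[]} _ _ _ _ =
  trans (∑-cong (λ i → trans (degℚ-∑ (addEdges G []) i)
                             (trans (∑-cong (λ j → cong ind (BoolP.∨-identityʳ (G i j)))) (sym (degℚ-∑ G i)))))
        (sym (ℚP.+-identityʳ (∑ (degℚ G))))
degree-sum-addEdges {G = G} {p ∷ 𝓛} symmetric (p₁≢p₂ All.∷ distinct) (nonEdge All.∷ nonEdges) (fresh AllPairs.∷ unique) = begin
  ∑ (degℚ (addEdges G (p ∷ 𝓛)))
    ≡⟨ ∑-cong (λ i → trans (degℚ-∑ (addEdges G (p ∷ 𝓛)) i) (∑-cong (ind-addEdges-∷ symmetric nonEdge fresh i))) ⟩
  ∑ (λ i → ∑ (λ j → ind (addEdges G 𝓛 i j) +q ind (joins p i j)))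
    ≡⟨ ∑-cong (λ i → ∑-distrib-+ (λ j → ind (addEdges G 𝓛 i j)) (λ j → ind (joins p i j))) ⟩
  ∑ (λ i → ∑ (λ j → ind (addEdges G 𝓛 i j)) +q ∑ (λ j → ind (joins p i j)))
    ≡⟨ ∑-distrib-+ (λ i → ∑ (λ j → ind (addEdges G 𝓛 i j))) (λ i → ∑ (λ j → ind (joins p i j))) ⟩
  ∑ (λ i → ∑ (λ j → ind (addEdges G 𝓛 i j))) +q ∑ (λ i → ∑ (λ j → ind (joins p i j)))
    ≡⟨ cong₂ _+q_ (trans (∑-cong (λ i → sym (degℚ-∑ (addEdges G 𝓛) i))) (degree-sum-addEdges symmetric distinct nonEdges unique))
                  (∑∑-ind-joins p p₁≢p₂) ⟩
  (∑ (degℚ G) +q (l +q l)) +q (1ℚ +q 1ℚ)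
    ≡⟨ solve 2 (λ t l → (t :+ (l :+ l)) :+ (con 1ℚ :+ con 1ℚ) := t :+ ((con 1ℚ :+ l) :+ (con 1ℚ :+ l))) refl (∑ (degℚ G)) l ⟩
  ∑ (degℚ G) +q ((1ℚ +q l) +q (1ℚ +q l))
    ≡⟨ cong (λ l′ → ∑ (degℚ G) +q (l′ +q l′)) (sym (ℕtoℚ-+ 1 (length 𝓛))) ⟩
  ∑ (degℚ G) +q (ℕtoℚ (suc (length 𝓛)) +q ℕtoℚ (suc (length 𝓛)))
    ∎
  where
  open ≡-Reasoning
  l = ℕtoℚ (length 𝓛)

edges-addEdges : ∀ {n} {G : Graph n} {𝓛} → IsSimple G →
                 All (λ p → proj₁ p ≢ proj₂ p) 𝓛 → All (λ p → G (proj₁ p) (proj₂ p) ≡ false) 𝓛 →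
                 AllPairs (λ p q → ¬ SamePair p q) 𝓛 → edges (addEdges G 𝓛) ≡ edges G ℕ.+ length 𝓛
edges-addEdges {G = G} {𝓛} simple distinct nonEdges unique =
  edges-from-degree-sum (edges G ℕ.+ length 𝓛) (addEdges-simple simple distinct) (begin
    ∑ (degℚ (addEdges G 𝓛))                ≡⟨ degree-sum-addEdges (proj₁ simple) distinct nonEdges unique ⟩
    ∑ (degℚ G) +q (l +q l)                 ≡⟨ cong (_+q (l +q l)) (handshake G simple) ⟩
    (m +q m) +q (l +q l)                   ≡⟨ solve 2 (λ m l → (m :+ m) :+ (l :+ l) := (m :+ l) :+ (m :+ l)) refl m l ⟩
    (m +q l) +q (m +q l)                   ≡⟨ sym (cong₂ _+q_ (ℕtoℚ-+ (edges G) (length 𝓛)) (ℕtoℚ-+ (edges G) (length 𝓛))) ⟩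
    ℕtoℚ (edges G ℕ.+ length 𝓛) +q ℕtoℚ (edges G ℕ.+ length 𝓛) ∎)
  where
  open ≡-Reasoning
  m = ℕtoℚ (edges G)
  l = ℕtoℚ (length 𝓛)

imageGraph-∨ : ∀ {m N} (e : Fin m → Fin N) (G G′ : Graph m) I J →
               imageGraph e (λ a b → G a b ∨ G′ a b) I J ≡ imageGraph e G I J ∨ imageGraph e G′ I J
imageGraph-∨ e G G′ I J = true-ext to from
  where
  to : imageGraph e (λ a b → G a b ∨ G′ a b) I J ≡ true → (imageGraph e G I J ∨ imageGraph e G′ I J) ≡ true
  to edge with imageGraph-elim e {λ a b → G a b ∨ G′ a b} I J edge
  ... | a , b , G∨G′ab , refl , refl with ∨-elim {G a b} G∨G′ab
  ...   | inj₁ Gab  = ∨-introˡ (imageGraph e G′ (e a) (e b)) (imageGraph-intro e {G} a b Gab)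
  ...   | inj₂ G′ab = ∨-introʳ (imageGraph e G (e a) (e b)) (imageGraph-intro e {G′} a b G′ab)
  from : (imageGraph e G I J ∨ imageGraph e G′ I J) ≡ true → imageGraph e (λ a b → G a b ∨ G′ a b) I J ≡ true
  from edge with ∨-elim {imageGraph e G I J} edge
  ... | inj₁ edge₁ with imageGraph-elim e {G} I J edge₁
  ...   | a , b , Gab , refl , refl = imageGraph-intro e {λ a b → G a b ∨ G′ a b} a b (∨-introˡ (G′ a b) Gab)
  from edge | inj₂ edge₂ with imageGraph-elim e {G′} I J edge₂
  ...   | a , b , G′ab , refl , refl = imageGraph-intro e {λ a b → G a b ∨ G′ a b} a b (∨-introʳ (G a b) G′ab)

imageGraph-added : ∀ {m N} (e : Fin m → Fin N) 𝓛 I J → imageGraph e (added 𝓛) I J ≡ added (map (mapPair e) 𝓛) I J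
imageGraph-added e 𝓛 I J = true-ext to from
  where
  to : imageGraph e (added 𝓛) I J ≡ true → added (map (mapPair e) 𝓛) I J ≡ true
  to edge with imageGraph-elim e I J edge
  ... | a , b , ab , refl , refl =
    added-intro (map (mapPair e) 𝓛) (e a) (e b) (AnyP.map⁺ (Any.map image (added-elim 𝓛 a b ab)))
    where
    image : ∀ {p} → Joins p a b → Joins (mapPair e p) (e a) (e b)
    image (inj₁ (refl , refl)) = inj₁ (refl , refl)
    image (inj₂ (refl , refl)) = inj₂ (refl , refl)
  from : added (map (mapPair e) 𝓛) I J ≡ true → imageGraph e (added 𝓛) I J ≡ true
  from edge with find (AnyP.map⁻ (added-elim (map (mapPair e) 𝓛) I J edge))
  ... | p , p∈𝓛 , inj₁ (refl , refl) =
    imageGraph-intro e {added 𝓛} (proj₁ p) (proj₂ p) (added-intro 𝓛 _ _ (Any.map (λ { refl → inj₁ (refl , refl) }) p∈𝓛))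
  ... | p , p∈𝓛 , inj₂ (refl , refl) =
    imageGraph-intro e {added 𝓛} (proj₂ p) (proj₁ p) (added-intro 𝓛 _ _ (Any.map (λ { refl → inj₂ (refl , refl) }) p∈𝓛))

kemenySum : ∀ {n} → Graph n → Mat n → ℚ
kemenySum H X = ∑ (λ i → ∑ (λ j → (degℚ H i *q degℚ H j) *q resistance X i j))

kemenySum-kemeny : ∀ {n} (H : Graph n) X → edges H ≥ 1 →
                   kemenySum H X ≡ ℕtoℚ 4 *q (ℕtoℚ (edges H) *q kemeny H X)
kemenySum-kemeny H X m≥1 with edges H | m≥1
... | suc m | _ = sym (begin
  ℕtoℚ 4 *q (ℕtoℚ (suc m) *q K)     ≡⟨ solve 3 (λ a b c → a :* (b :* c) := c :* (a :* b)) refl (ℕtoℚ 4) (ℕtoℚ (suc m)) K ⟩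
  K *q (ℕtoℚ 4 *q ℕtoℚ (suc m))     ≡⟨ cong (K *q_) (sym (ℕtoℚ-* 4 (suc m))) ⟩
  K *q ℕtoℚ (4 ℕ.* suc m)           ≡⟨ divℕ-*-cancel (kemenySum H X) (m ℕ.+ 3 ℕ.* suc m) ⟩
  kemenySum H X                     ∎)
  where
  open ≡-Reasoning
  K = divℕ (kemenySum H X) (4 ℕ.* suc m)

kemenySum-moments : ∀ {n} (H : Graph n) X → kemenySum H X ≡ ⟨ degℚ H , moment H X ⟩
kemenySum-moments H X = begin
  ∑ (λ i → ∑ (λ j → (d i *q d j) *q resistance X i j))   ≡⟨ ∑-comm (λ i j → (d i *q d j) *q resistance X i j) ⟩
  ∑ (λ j → ∑ (λ i → (d i *q d j) *q resistance X i j))   ≡⟨ ∑-cong (λ j → ∑-cong (λ i → rearrange (d i) (d j) (resistance X i j))) ⟩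
  ∑ (λ j → ∑ (λ i → d j *q (d i *q resistance X i j)))   ≡⟨ ∑-cong (λ j → sym (*-distribˡ-∑ (d j) (λ i → d i *q resistance X i j))) ⟩
  ⟨ d , moment H X ⟩                                     ∎
  where
  open ≡-Reasoning
  d = degℚ H
  rearrange : ∀ a b c → (a *q b) *q c ≡ b *q (a *q c)
  rearrange = solve 3 (λ a b c → (a :* b) :* c := b :* (a :* c)) refl

moment-sym : ∀ {n} (H : Graph n) X v → ⟨ degℚ H , resistance X v ⟩ ≡ moment H X v
moment-sym H X v = ⟨⟩-congʳ (degℚ H) (resistance-sym X v)

⟨⟩-affine : ∀ {n} (d f g : Fin n → ℚ) c t →
            ⟨ d , (λ i → f i +q (c +q t *q g i)) ⟩ ≡ ⟨ d , f ⟩ +q (∑ d *q c +q t *q ⟨ d , g ⟩)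
⟨⟩-affine d f g c t = begin
  ∑ (λ i → d i *q (f i +q (c +q t *q g i)))
    ≡⟨ ∑-cong (λ i → solve 5 (λ d f g c t → d :* (f :+ (c :+ t :* g)) := d :* f :+ (d :* c :+ t :* (d :* g))) refl (d i) (f i) (g i) c t) ⟩
  ∑ (λ i → d i *q f i +q (d i *q c +q t *q (d i *q g i)))
    ≡⟨ ∑-distrib-+ (λ i → d i *q f i) (λ i → d i *q c +q t *q (d i *q g i)) ⟩
  ⟨ d , f ⟩ +q ∑ (λ i → d i *q c +q t *q (d i *q g i))
    ≡⟨ cong (⟨ d , f ⟩ +q_) (∑-distrib-+ (λ i → d i *q c) (λ i → t *q (d i *q g i))) ⟩
  ⟨ d , f ⟩ +q (∑ (λ i → d i *q c) +q ∑ (λ i → t *q (d i *q g i)))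
    ≡⟨ cong (⟨ d , f ⟩ +q_) (sym (cong₂ _+q_ (*-distribʳ-∑ c d) (*-distribˡ-∑ t (λ i → d i *q g i)))) ⟩
  ⟨ d , f ⟩ +q (∑ d *q c +q t *q ⟨ d , g ⟩)
    ∎
  where open ≡-Reasoning

module OneSum {n₁ k} (G₁ : Graph n₁) (G₂ : Graph (suc k)) (v₁ : Fin n₁) (v₂ : Fin (suc k)) where

  e₁ : Fin n₁ → Fin (n₁ ℕ.+ k)
  e₁ = emb₁ k

  e₂ : Fin (suc k) → Fin (n₁ ℕ.+ k)
  e₂ = emb₂ v₁ v₂

  ↑ˡ≢↑ʳ : ∀ (a : Fin n₁) (u : Fin k) → a ↑ˡ k ≢ n₁ ↑ʳ u
  ↑ˡ≢↑ʳ a u eq with () ← trans (sym (FP.splitAt-↑ˡ n₁ a k)) (trans (cong (splitAt n₁) eq) (FP.splitAt-↑ʳ n₁ k u))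

  e₁-injective : Injective _≡_ _≡_ e₁
  e₁-injective = FP.↑ˡ-injective k _ _

  e₂-v₂ : e₂ v₂ ≡ e₁ v₁
  e₂-v₂ with v₂ F.≟ v₂
  ... | yes _ = refl
  ... | no v₂≢v₂ = ⊥-elim (v₂≢v₂ refl)

  e₂-injective : Injective _≡_ _≡_ e₂
  e₂-injective {w} {w′} eq with v₂ F.≟ w | v₂ F.≟ w′
  ... | yes v₂≡w | yes v₂≡w′ = trans (sym v₂≡w) v₂≡w′
  ... | yes _    | no _      = ⊥-elim (↑ˡ≢↑ʳ v₁ _ eq)
  ... | no _     | yes _     = ⊥-elim (↑ˡ≢↑ʳ v₁ _ (sym eq))
  ... | no v₂≢w  | no v₂≢w′  = FP.punchOut-injective v₂≢w v₂≢w′ (FP.↑ʳ-injective n₁ _ _ eq)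

  e₁≡e₂⇒v₁ : ∀ {a w} → e₁ a ≡ e₂ w → a ≡ v₁
  e₁≡e₂⇒v₁ {a} {w} eq with v₂ F.≟ w
  ... | yes _ = e₁-injective eq
  ... | no _  = ⊥-elim (↑ˡ≢↑ʳ a _ eq)

  glue : (Fin n₁ → ℚ) → (Fin (suc k) → ℚ) → Fin (n₁ ℕ.+ k) → ℚ
  glue f₁ f₂ I = [ f₁ , f₂ ∘ punchIn v₂ ]′ (splitAt n₁ I)

  glue-e₁ : ∀ f₁ f₂ a → glue f₁ f₂ (e₁ a) ≡ f₁ a
  glue-e₁ f₁ f₂ a rewrite FP.splitAt-↑ˡ n₁ a k = refl

  glue-e₂ : ∀ f₁ f₂ → f₁ v₁ ≡ f₂ v₂ → ∀ w → glue f₁ f₂ (e₂ w) ≡ f₂ w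
  glue-e₂ f₁ f₂ agree w with v₂ F.≟ w
  ... | yes refl = trans (glue-e₁ f₁ f₂ v₁) agree
  ... | no v₂≢w rewrite FP.splitAt-↑ʳ n₁ k (punchOut v₂≢w) = cong f₂ (FP.punchIn-punchOut v₂≢w)

  e₂-nonEdge : ∀ {a b} → oneSum G₁ v₁ G₂ v₂ (e₂ a) (e₂ b) ≡ false → G₂ a b ≡ false
  e₂-nonEdge {a} {b} nonEdge = ≢true⇒≡false λ Gab →
    true≢false (trans (sym (∨-introʳ (imageGraph e₁ G₁ (e₂ a) (e₂ b)) (imageGraph-intro e₂ {G₂} a b Gab))) nonEdge)

  addEdges-oneSum : ∀ 𝓛 I J → addEdges (oneSum G₁ v₁ G₂ v₂) (map (mapPair e₂) 𝓛) I J ≡ oneSum G₁ v₁ (addEdges G₂ 𝓛) v₂ I J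
  addEdges-oneSum 𝓛 I J = begin
    (image₁ ∨ imageGraph e₂ G₂ I J) ∨ added (map (mapPair e₂) 𝓛) I J   ≡⟨ BoolP.∨-assoc image₁ _ _ ⟩
    image₁ ∨ (imageGraph e₂ G₂ I J ∨ added (map (mapPair e₂) 𝓛) I J)   ≡⟨ cong (λ x → image₁ ∨ (imageGraph e₂ G₂ I J ∨ x)) (sym (imageGraph-added e₂ 𝓛 I J)) ⟩
    image₁ ∨ (imageGraph e₂ G₂ I J ∨ imageGraph e₂ (added 𝓛) I J)     ≡⟨ cong (image₁ ∨_) (sym (imageGraph-∨ e₂ G₂ (added 𝓛) I J)) ⟩
    oneSum G₁ v₁ (addEdges G₂ 𝓛) v₂ I J                                ∎
    where
    open ≡-Reasoning
    image₁ = imageGraph e₁ G₁ I J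

  module _ (simple₁ : IsSimple G₁) (simple₂ : IsSimple G₂)
           {H : Graph (n₁ ℕ.+ k)} (H≗ : ∀ I J → H I J ≡ oneSum G₁ v₁ G₂ v₂ I J) where

    -- Only v is shared, and G₁ has no loop at v.
    parts-disjoint : ∀ I J → (imageGraph e₁ G₁ I J ∧ imageGraph e₂ G₂ I J) ≡ false
    parts-disjoint I J = ≢true⇒≡false λ both →
      let (edge₁ , edge₂) = ∧-elim {imageGraph e₁ G₁ I J} both
      in  shared-loop (imageGraph-elim e₁ I J edge₁) (imageGraph-elim e₂ I J edge₂)
      where
      shared-loop : (∃ λ a → ∃ λ b → G₁ a b ≡ true × e₁ a ≡ I × e₁ b ≡ J) →
                    (∃ λ w → ∃ λ w′ → G₂ w w′ ≡ true × e₂ w ≡ I × e₂ w′ ≡ J) → ⊥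
      shared-loop (a , b , Gab , refl , refl) (_ , _ , _ , ea≡ , eb≡) with e₁≡e₂⇒v₁ (sym ea≡) | e₁≡e₂⇒v₁ (sym eb≡)
      ... | refl | refl with () ← trans (sym Gab) (proj₂ simple₁ v₁)

    oneSum-simple : IsSimple H
    oneSum-simple =
      (λ I J → trans (H≗ I J) (trans (cong₂ _∨_ (imageGraph-symmetric e₁ (proj₁ simple₁) I J)
                                                 (imageGraph-symmetric e₂ (proj₁ simple₂) I J))
                                     (sym (H≗ J I)))) ,
      (λ I → trans (H≗ I I) (cong₂ _∨_ (imageGraph-loopless e₁-injective G₁ (proj₂ simple₁) I)
                                        (imageGraph-loopless e₂-injective G₂ (proj₂ simple₂) I)))

    ∑-ind-oneSum : ∀ I (g : Fin (n₁ ℕ.+ k) → ℚ) →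
                   ∑ (λ J → ind (H I J) *q g J)
                   ≡ push e₁ (λ a → ∑ (λ b → ind (G₁ a b) *q g (e₁ b))) I +q push e₂ (λ w → ∑ (λ w′ → ind (G₂ w w′) *q g (e₂ w′))) I
    ∑-ind-oneSum I g = begin
      ∑ (λ J → ind (H I J) *q g J)
        ≡⟨ ∑-cong (λ J → trans (cong (λ b → ind b *q g J) (H≗ I J))
                               (trans (cong (_*q g J) (ind-∨ (imageGraph e₁ G₁ I J) (imageGraph e₂ G₂ I J) (parts-disjoint I J)))
                                      (ℚP.*-distribʳ-+ (g J) (ind (imageGraph e₁ G₁ I J)) (ind (imageGraph e₂ G₂ I J))))) ⟩
      ∑ (λ J → ind (imageGraph e₁ G₁ I J) *q g J +q ind (imageGraph e₂ G₂ I J) *q g J)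
        ≡⟨ ∑-distrib-+ (λ J → ind (imageGraph e₁ G₁ I J) *q g J) (λ J → ind (imageGraph e₂ G₂ I J) *q g J) ⟩
      ∑ (λ J → ind (imageGraph e₁ G₁ I J) *q g J) +q ∑ (λ J → ind (imageGraph e₂ G₂ I J) *q g J)
        ≡⟨ cong₂ _+q_ (∑-ind-imageGraph e₁-injective G₁ I g) (∑-ind-imageGraph e₂-injective G₂ I g) ⟩
      push e₁ (λ a → ∑ (λ b → ind (G₁ a b) *q g (e₁ b))) I +q push e₂ (λ w → ∑ (λ w′ → ind (G₂ w w′) *q g (e₂ w′))) I
        ∎
      where open ≡-Reasoning

    degℚ-oneSum : ∀ I → degℚ H I ≡ push e₁ (degℚ G₁) I +q push e₂ (degℚ G₂) I
    degℚ-oneSum I = begin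
      degℚ H I                                   ≡⟨ degℚ-∑ H I ⟩
      ∑ (λ J → ind (H I J))                      ≡⟨ sym (⟨⟩-oneʳ (ind ∘ H I)) ⟩
      ∑ (λ J → ind (H I J) *q 1ℚ)                ≡⟨ ∑-ind-oneSum I (λ _ → 1ℚ) ⟩
      push e₁ (λ a → ⟨ ind ∘ G₁ a , (λ _ → 1ℚ) ⟩) I +q push e₂ (λ w → ⟨ ind ∘ G₂ w , (λ _ → 1ℚ) ⟩) I
        ≡⟨ cong₂ _+q_ (push-cong e₁ (λ a → trans (⟨⟩-oneʳ (ind ∘ G₁ a)) (sym (degℚ-∑ G₁ a))) I)
                      (push-cong e₂ (λ w → trans (⟨⟩-oneʳ (ind ∘ G₂ w)) (sym (degℚ-∑ G₂ w))) I) ⟩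
      push e₁ (degℚ G₁) I +q push e₂ (degℚ G₂) I ∎
      where open ≡-Reasoning

    ⟨degℚ⟩-oneSum : ∀ h → ⟨ degℚ H , h ⟩ ≡ ⟨ degℚ G₁ , h ∘ e₁ ⟩ +q ⟨ degℚ G₂ , h ∘ e₂ ⟩
    ⟨degℚ⟩-oneSum h = begin
      ⟨ degℚ H , h ⟩                                                   ≡⟨ ∑-cong (λ I → cong (_*q h I) (degℚ-oneSum I)) ⟩
      ⟨ (λ I → push e₁ (degℚ G₁) I +q push e₂ (degℚ G₂) I) , h ⟩       ≡⟨ ⟨⟩-distribˡ-+ (push e₁ (degℚ G₁)) (push e₂ (degℚ G₂)) h ⟩
      ⟨ push e₁ (degℚ G₁) , h ⟩ +q ⟨ push e₂ (degℚ G₂) , h ⟩           ≡⟨ cong₂ _+q_ (⟨push⟩ e₁ (degℚ G₁) h) (⟨push⟩ e₂ (degℚ G₂) h) ⟩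
      ⟨ degℚ G₁ , h ∘ e₁ ⟩ +q ⟨ degℚ G₂ , h ∘ e₂ ⟩                     ∎
      where open ≡-Reasoning

    laplacian-oneSum : ∀ x I → (laplacian H · x) I
                               ≡ push e₁ (laplacian G₁ · (x ∘ e₁)) I +q push e₂ (laplacian G₂ · (x ∘ e₂)) I
    laplacian-oneSum x I = begin
      (laplacian H · x) I                                 ≡⟨ laplacian-· (proj₂ oneSum-simple) x I ⟩
      ∑ (λ J → ind (H I J) *q (x I -q x J))               ≡⟨ ∑-ind-oneSum I (λ J → x I -q x J) ⟩
      push e₁ (λ a → F₁ a I) I +q push e₂ (λ w → F₂ w I) I
        ≡⟨ cong₂ _+q_ (∑-cong (λ a → trans (δ-subst (e₁ a) I (F₁ a))
                                           (cong (δ (e₁ a) I *q_) (sym (laplacian-· {H = G₁} (proj₂ simple₁) (x ∘ e₁) a)))))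
                      (∑-cong (λ w → trans (δ-subst (e₂ w) I (F₂ w))
                                           (cong (δ (e₂ w) I *q_) (sym (laplacian-· {H = G₂} (proj₂ simple₂) (x ∘ e₂) w))))) ⟩
      push e₁ (laplacian G₁ · (x ∘ e₁)) I +q push e₂ (laplacian G₂ · (x ∘ e₂)) I ∎
      where
      open ≡-Reasoning
      F₁ : Fin n₁ → Fin (n₁ ℕ.+ k) → ℚ
      F₁ a J = ∑ (λ b → ind (G₁ a b) *q (x J -q x (e₁ b)))
      F₂ : Fin (suc k) → Fin (n₁ ℕ.+ k) → ℚ
      F₂ w J = ∑ (λ w′ → ind (G₂ w w′) *q (x J -q x (e₂ w′)))

    edges-oneSum : edges H ≡ edges G₁ ℕ.+ edges G₂
    edges-oneSum = edges-from-degree-sum (edges G₁ ℕ.+ edges G₂) oneSum-simple (begin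
      ∑ (degℚ H)                                    ≡⟨ sym (⟨⟩-oneʳ (degℚ H)) ⟩
      ⟨ degℚ H , (λ _ → 1ℚ) ⟩                       ≡⟨ ⟨degℚ⟩-oneSum (λ _ → 1ℚ) ⟩
      ⟨ degℚ G₁ , (λ _ → 1ℚ) ⟩ +q ⟨ degℚ G₂ , (λ _ → 1ℚ) ⟩
        ≡⟨ cong₂ _+q_ (trans (⟨⟩-oneʳ (degℚ G₁)) (handshake G₁ simple₁)) (trans (⟨⟩-oneʳ (degℚ G₂)) (handshake G₂ simple₂)) ⟩
      (M₁ +q M₁) +q (M₂ +q M₂)                      ≡⟨ solve 2 (λ a b → (a :+ a) :+ (b :+ b) := (a :+ b) :+ (a :+ b)) refl M₁ M₂ ⟩
      (M₁ +q M₂) +q (M₁ +q M₂)                      ≡⟨ sym (cong₂ _+q_ (ℕtoℚ-+ (edges G₁) (edges G₂)) (ℕtoℚ-+ (edges G₁) (edges G₂))) ⟩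
      ℕtoℚ (edges G₁ ℕ.+ edges G₂) +q ℕtoℚ (edges G₁ ℕ.+ edges G₂) ∎)
      where
      open ≡-Reasoning
      M₁ = ℕtoℚ (edges G₁)
      M₂ = ℕtoℚ (edges G₂)

    module _ (connected₁ : Connected G₁) (connected₂ : Connected G₂) (X₁ : Mat n₁) (X₂ : Mat (suc k))
             (X : Mat (n₁ ℕ.+ k)) (ginv₁ : IsGeneralizedInverse (laplacian G₁) X₁)
             (ginv₂ : IsGeneralizedInverse (laplacian G₂) X₂) (ginv : IsGeneralizedInverse (laplacian H) X) where

      -- The potentials X₁ α and X₂ β, shifted to vanish at v, glue to a potential x on H with L x = b.
      quad-oneSum : ∀ α β → ∑ α ≡ 0ℚ → ∑ β ≡ 0ℚ →
                    quad X (λ I → push e₁ α I +q push e₂ β I) ≡ quad X₁ α +q quad X₂ β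
      quad-oneSum α β ∑α≡0 ∑β≡0 = begin
        quad X b                                  ≡⟨ quad-cong X (λ I → sym (L-x I)) ⟩
        quad X (laplacian H · x)                  ≡⟨ quad-generalizedInverse (laplacian-sym oneSum-simple) ginv x ⟩
        ⟨ x , laplacian H · x ⟩                   ≡⟨ trans (⟨⟩-congʳ x L-x) (⟨⟩-comm x b) ⟩
        ⟨ b , x ⟩                                 ≡⟨ ⟨⟩-distribˡ-+ (push e₁ α) (push e₂ β) x ⟩
        ⟨ push e₁ α , x ⟩ +q ⟨ push e₂ β , x ⟩    ≡⟨ cong₂ _+q_ (⟨push⟩ e₁ α x) (⟨push⟩ e₂ β x) ⟩
        ⟨ α , x ∘ e₁ ⟩ +q ⟨ β , x ∘ e₂ ⟩
          ≡⟨ cong₂ _+q_ (trans (⟨⟩-congʳ α x-e₁) (⟨⟩-shift α φ₁ (φ₁ v₁) ∑α≡0))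
                        (trans (⟨⟩-congʳ β x-e₂) (⟨⟩-shift β φ₂ (φ₂ v₂) ∑β≡0)) ⟩
        quad X₁ α +q quad X₂ β                    ∎
        where
        open ≡-Reasoning
        b : Fin (n₁ ℕ.+ k) → ℚ
        b I = push e₁ α I +q push e₂ β I
        φ₁ = X₁ · α
        φ₂ = X₂ · β
        f₁ : Fin n₁ → ℚ
        f₁ a = φ₁ a -q φ₁ v₁
        f₂ : Fin (suc k) → ℚ
        f₂ w = φ₂ w -q φ₂ v₂
        x : Fin (n₁ ℕ.+ k) → ℚ
        x = glue f₁ f₂
        x-e₁ : ∀ a → x (e₁ a) ≡ f₁ a
        x-e₁ = glue-e₁ f₁ f₂
        x-e₂ : ∀ w → x (e₂ w) ≡ f₂ w
        x-e₂ = glue-e₂ f₁ f₂ (trans (ℚP.+-inverseʳ (φ₁ v₁)) (sym (ℚP.+-inverseʳ (φ₂ v₂))))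
        L₁-x : ∀ a → (laplacian G₁ · (x ∘ e₁)) a ≡ α a
        L₁-x a = trans (·-congʳ (laplacian G₁) x-e₁ a)
                       (trans (laplacian-shift {H = G₁} (proj₂ simple₁) φ₁ (φ₁ v₁) a)
                              (laplacian-generalizedInverse {H = G₁} {X₁} simple₁ connected₁ ginv₁ α ∑α≡0 a))
        L₂-x : ∀ w → (laplacian G₂ · (x ∘ e₂)) w ≡ β w
        L₂-x w = trans (·-congʳ (laplacian G₂) x-e₂ w)
                       (trans (laplacian-shift {H = G₂} (proj₂ simple₂) φ₂ (φ₂ v₂) w)
                              (laplacian-generalizedInverse {H = G₂} {X₂} simple₂ connected₂ ginv₂ β ∑β≡0 w))
        L-x : ∀ I → (laplacian H · x) I ≡ b I
        L-x I = trans (laplacian-oneSum x I) (cong₂ _+q_ (push-cong e₁ L₁-x I) (push-cong e₂ L₂-x I))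

      resistance-oneSum₁₁ : ∀ a b → resistance X (e₁ a) (e₁ b) ≡ resistance X₁ a b
      resistance-oneSum₁₁ a b = begin
        resistance X (e₁ a) (e₁ b)                               ≡⟨ sym (quad-δ-diff X (e₁ a) (e₁ b)) ⟩
        quad X (δ-diff (e₁ a) (e₁ b))                            ≡⟨ quad-cong X split ⟩
        quad X (λ I → push e₁ (δ-diff a b) I +q push e₂ 0⃗ I)    ≡⟨ quad-oneSum (δ-diff a b) 0⃗ (∑-δ-diff a b) (∑-zero (suc k)) ⟩
        quad X₁ (δ-diff a b) +q quad X₂ 0⃗                       ≡⟨ cong₂ _+q_ (quad-δ-diff X₁ a b) (quad-zero X₂) ⟩
        resistance X₁ a b +q 0ℚ                                  ≡⟨ ℚP.+-identityʳ _ ⟩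
        resistance X₁ a b                                        ∎
        where
        open ≡-Reasoning
        0⃗ : Fin (suc k) → ℚ
        0⃗ _ = 0ℚ
        split : ∀ I → δ-diff (e₁ a) (e₁ b) I ≡ push e₁ (δ-diff a b) I +q push e₂ 0⃗ I
        split I = sym (trans (cong₂ _+q_ (push-δ-diff e₁ a b I) (push-zero e₂ I)) (ℚP.+-identityʳ _))

      resistance-oneSum₂₂ : ∀ w w′ → resistance X (e₂ w) (e₂ w′) ≡ resistance X₂ w w′
      resistance-oneSum₂₂ w w′ = begin
        resistance X (e₂ w) (e₂ w′)                              ≡⟨ sym (quad-δ-diff X (e₂ w) (e₂ w′)) ⟩
        quad X (δ-diff (e₂ w) (e₂ w′))                           ≡⟨ quad-cong X split ⟩
        quad X (λ I → push e₁ 0⃗ I +q push e₂ (δ-diff w w′) I)   ≡⟨ quad-oneSum 0⃗ (δ-diff w w′) (∑-zero n₁) (∑-δ-diff w w′) ⟩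
        quad X₁ 0⃗ +q quad X₂ (δ-diff w w′)                      ≡⟨ cong₂ _+q_ (quad-zero X₁) (quad-δ-diff X₂ w w′) ⟩
        0ℚ +q resistance X₂ w w′                                 ≡⟨ ℚP.+-identityˡ _ ⟩
        resistance X₂ w w′                                       ∎
        where
        open ≡-Reasoning
        0⃗ : Fin n₁ → ℚ
        0⃗ _ = 0ℚ
        split : ∀ I → δ-diff (e₂ w) (e₂ w′) I ≡ push e₁ 0⃗ I +q push e₂ (δ-diff w w′) I
        split I = sym (trans (cong₂ _+q_ (push-zero e₁ I) (push-δ-diff e₂ w w′ I)) (ℚP.+-identityˡ _))

      -- A unit current from e₁ a to e₂ w is a current from a to v in G₁ plus one from v to w in G₂.
      resistance-oneSum₁₂ : ∀ a w → resistance X (e₁ a) (e₂ w) ≡ resistance X₁ a v₁ +q resistance X₂ v₂ w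
      resistance-oneSum₁₂ a w = begin
        resistance X (e₁ a) (e₂ w)                                          ≡⟨ sym (quad-δ-diff X (e₁ a) (e₂ w)) ⟩
        quad X (δ-diff (e₁ a) (e₂ w))                                       ≡⟨ quad-cong X split ⟩
        quad X (λ I → push e₁ (δ-diff a v₁) I +q push e₂ (δ-diff v₂ w) I)  ≡⟨ quad-oneSum (δ-diff a v₁) (δ-diff v₂ w) (∑-δ-diff a v₁) (∑-δ-diff v₂ w) ⟩
        quad X₁ (δ-diff a v₁) +q quad X₂ (δ-diff v₂ w)                      ≡⟨ cong₂ _+q_ (quad-δ-diff X₁ a v₁) (quad-δ-diff X₂ v₂ w) ⟩
        resistance X₁ a v₁ +q resistance X₂ v₂ w                            ∎
        where
        open ≡-Reasoning
        split : ∀ I → δ-diff (e₁ a) (e₂ w) I ≡ push e₁ (δ-diff a v₁) I +q push e₂ (δ-diff v₂ w) I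
        split I = sym (begin
          push e₁ (δ-diff a v₁) I +q push e₂ (δ-diff v₂ w) I         ≡⟨ cong₂ _+q_ (push-δ-diff e₁ a v₁ I) (push-δ-diff e₂ v₂ w I) ⟩
          δ-diff (e₁ a) (e₁ v₁) I +q δ-diff (e₂ v₂) (e₂ w) I         ≡⟨ cong (λ u → δ-diff (e₁ a) (e₁ v₁) I +q δ-diff u (e₂ w) I) e₂-v₂ ⟩
          δ-diff (e₁ a) (e₁ v₁) I +q δ-diff (e₁ v₁) (e₂ w) I         ≡⟨ solve 3 (λ p q r → (p :- q) :+ (q :- r) := p :- r) refl (δ (e₁ a) I) (δ (e₁ v₁) I) (δ (e₂ w) I) ⟩
          δ-diff (e₁ a) (e₂ w) I                                     ∎)

      moment-oneSum₁ : ∀ a → moment H X (e₁ a)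
                             ≡ moment G₁ X₁ a +q (moment G₂ X₂ v₂ +q ∑ (degℚ G₂) *q resistance X₁ a v₁)
      moment-oneSum₁ a = begin
        moment H X (e₁ a)
          ≡⟨ ⟨degℚ⟩-oneSum (λ I → resistance X I (e₁ a)) ⟩
        ⟨ degℚ G₁ , (λ b → resistance X (e₁ b) (e₁ a)) ⟩ +q ⟨ degℚ G₂ , (λ w → resistance X (e₂ w) (e₁ a)) ⟩
          ≡⟨ cong₂ _+q_ (⟨⟩-congʳ (degℚ G₁) (λ b → resistance-oneSum₁₁ b a))
                        (⟨⟩-congʳ (degℚ G₂) (λ w → trans (resistance-sym X (e₂ w) (e₁ a)) (resistance-oneSum₁₂ a w))) ⟩
        moment G₁ X₁ a +q ⟨ degℚ G₂ , (λ w → resistance X₁ a v₁ +q resistance X₂ v₂ w) ⟩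
          ≡⟨ cong (moment G₁ X₁ a +q_) (⟨⟩-const-+ (degℚ G₂) (resistance X₂ v₂) (resistance X₁ a v₁)) ⟩
        moment G₁ X₁ a +q (∑ (degℚ G₂) *q resistance X₁ a v₁ +q ⟨ degℚ G₂ , resistance X₂ v₂ ⟩)
          ≡⟨ cong (moment G₁ X₁ a +q_) (trans (ℚP.+-comm (∑ (degℚ G₂) *q resistance X₁ a v₁) _)
                                              (cong (_+q ∑ (degℚ G₂) *q resistance X₁ a v₁) (moment-sym G₂ X₂ v₂))) ⟩
        moment G₁ X₁ a +q (moment G₂ X₂ v₂ +q ∑ (degℚ G₂) *q resistance X₁ a v₁)
          ∎
        where open ≡-Reasoning

      moment-oneSum₂ : ∀ w → moment H X (e₂ w)
                             ≡ moment G₂ X₂ w +q (moment G₁ X₁ v₁ +q ∑ (degℚ G₁) *q resistance X₂ w v₂)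
      moment-oneSum₂ w = begin
        moment H X (e₂ w)
          ≡⟨ ⟨degℚ⟩-oneSum (λ I → resistance X I (e₂ w)) ⟩
        ⟨ degℚ G₁ , (λ a → resistance X (e₁ a) (e₂ w)) ⟩ +q ⟨ degℚ G₂ , (λ w′ → resistance X (e₂ w′) (e₂ w)) ⟩
          ≡⟨ cong₂ _+q_ (⟨⟩-congʳ (degℚ G₁) (λ a → trans (resistance-oneSum₁₂ a w)
                                                         (trans (ℚP.+-comm (resistance X₁ a v₁) (resistance X₂ v₂ w))
                                                                (cong (_+q resistance X₁ a v₁) (resistance-sym X₂ v₂ w)))))
                        (⟨⟩-congʳ (degℚ G₂) (λ w′ → resistance-oneSum₂₂ w′ w)) ⟩
        ⟨ degℚ G₁ , (λ a → resistance X₂ w v₂ +q resistance X₁ a v₁) ⟩ +q moment G₂ X₂ w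
          ≡⟨ cong (_+q moment G₂ X₂ w) (⟨⟩-const-+ (degℚ G₁) (λ a → resistance X₁ a v₁) (resistance X₂ w v₂)) ⟩
        (∑ (degℚ G₁) *q resistance X₂ w v₂ +q moment G₁ X₁ v₁) +q moment G₂ X₂ w
          ≡⟨ solve 3 (λ t μ μ′ → (t :+ μ) :+ μ′ := μ′ :+ (μ :+ t)) refl (∑ (degℚ G₁) *q resistance X₂ w v₂) (moment G₁ X₁ v₁) (moment G₂ X₂ w) ⟩
        moment G₂ X₂ w +q (moment G₁ X₁ v₁ +q ∑ (degℚ G₁) *q resistance X₂ w v₂)
          ∎
        where open ≡-Reasoning

      kemenySum-oneSum : let μ₁ = moment G₁ X₁ v₁; μ₂ = moment G₂ X₂ v₂ in
                         kemenySum H X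
                         ≡ (kemenySum G₁ X₁ +q (∑ (degℚ G₁) *q μ₂ +q ∑ (degℚ G₂) *q μ₁))
                           +q (kemenySum G₂ X₂ +q (∑ (degℚ G₂) *q μ₁ +q ∑ (degℚ G₁) *q μ₂))
      kemenySum-oneSum = begin
        kemenySum H X
          ≡⟨ kemenySum-moments H X ⟩
        ⟨ degℚ H , moment H X ⟩
          ≡⟨ ⟨degℚ⟩-oneSum (moment H X) ⟩
        ⟨ degℚ G₁ , moment H X ∘ e₁ ⟩ +q ⟨ degℚ G₂ , moment H X ∘ e₂ ⟩
          ≡⟨ cong₂ _+q_ (⟨⟩-congʳ (degℚ G₁) moment-oneSum₁) (⟨⟩-congʳ (degℚ G₂) moment-oneSum₂) ⟩
        ⟨ degℚ G₁ , (λ a → moment G₁ X₁ a +q (μ₂ +q ∑ (degℚ G₂) *q resistance X₁ a v₁)) ⟩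
          +q ⟨ degℚ G₂ , (λ w → moment G₂ X₂ w +q (μ₁ +q ∑ (degℚ G₁) *q resistance X₂ w v₂)) ⟩
          ≡⟨ cong₂ _+q_ (⟨⟩-affine (degℚ G₁) (moment G₁ X₁) (λ a → resistance X₁ a v₁) μ₂ (∑ (degℚ G₂)))
                        (⟨⟩-affine (degℚ G₂) (moment G₂ X₂) (λ w → resistance X₂ w v₂) μ₁ (∑ (degℚ G₁))) ⟩
        (⟨ degℚ G₁ , moment G₁ X₁ ⟩ +q (∑ (degℚ G₁) *q μ₂ +q ∑ (degℚ G₂) *q μ₁))
          +q (⟨ degℚ G₂ , moment G₂ X₂ ⟩ +q (∑ (degℚ G₂) *q μ₁ +q ∑ (degℚ G₁) *q μ₂))
          ≡⟨ sym (cong₂ (λ S₁ S₂ → (S₁ +q cross₁) +q (S₂ +q cross₂)) (kemenySum-moments G₁ X₁) (kemenySum-moments G₂ X₂)) ⟩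
        (kemenySum G₁ X₁ +q (∑ (degℚ G₁) *q μ₂ +q ∑ (degℚ G₂) *q μ₁))
          +q (kemenySum G₂ X₂ +q (∑ (degℚ G₂) *q μ₁ +q ∑ (degℚ G₁) *q μ₂))
          ∎
        where
        open ≡-Reasoning
        μ₁ = moment G₁ X₁ v₁
        μ₂ = moment G₂ X₂ v₂
        cross₁ = ∑ (degℚ G₁) *q μ₂ +q ∑ (degℚ G₂) *q μ₁
        cross₂ = ∑ (degℚ G₂) *q μ₁ +q ∑ (degℚ G₁) *q μ₂

      kemeny-oneSum : edges G₁ ≥ 1 → edges G₂ ≥ 1 →
                      let M₁ = ℕtoℚ (edges G₁); M₂ = ℕtoℚ (edges G₂) in
                      (M₁ +q M₂) *q kemeny H X
                      ≡ ((M₁ *q kemeny G₁ X₁ +q M₂ *q kemeny G₂ X₂) +q M₂ *q moment G₁ X₁ v₁) +q M₁ *q moment G₂ X₂ v₂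
      kemeny-oneSum m₁≥1 m₂≥1 = *-cancelˡ-≡ four (begin
        four *q ((M₁ +q M₂) *q K)
          ≡⟨ cong (λ m → four *q (m *q K)) (sym (trans (cong ℕtoℚ edges-oneSum) (ℕtoℚ-+ (edges G₁) (edges G₂)))) ⟩
        four *q (ℕtoℚ (edges H) *q K)
          ≡⟨ sym (kemenySum-kemeny H X m≥1) ⟩
        kemenySum H X
          ≡⟨ kemenySum-oneSum ⟩
        (kemenySum G₁ X₁ +q (T₁ *q μ₂ +q T₂ *q μ₁)) +q (kemenySum G₂ X₂ +q (T₂ *q μ₁ +q T₁ *q μ₂))
          ≡⟨ cong₂ (λ S₁ S₂ → (S₁ +q (T₁ *q μ₂ +q T₂ *q μ₁)) +q (S₂ +q (T₂ *q μ₁ +q T₁ *q μ₂)))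
                   (kemenySum-kemeny G₁ X₁ m₁≥1) (kemenySum-kemeny G₂ X₂ m₂≥1) ⟩
        (four *q (M₁ *q K₁) +q (T₁ *q μ₂ +q T₂ *q μ₁)) +q (four *q (M₂ *q K₂) +q (T₂ *q μ₁ +q T₁ *q μ₂))
          ≡⟨ cong₂ (λ t₁ t₂ → (four *q (M₁ *q K₁) +q (t₁ *q μ₂ +q t₂ *q μ₁)) +q (four *q (M₂ *q K₂) +q (t₂ *q μ₁ +q t₁ *q μ₂)))
                   (handshake G₁ simple₁) (handshake G₂ simple₂) ⟩
        (four *q (M₁ *q K₁) +q ((M₁ +q M₁) *q μ₂ +q (M₂ +q M₂) *q μ₁))
          +q (four *q (M₂ *q K₂) +q ((M₂ +q M₂) *q μ₁ +q (M₁ +q M₁) *q μ₂))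
          ≡⟨ solve 6 (λ m₁ m₂ k₁ k₂ u₁ u₂ →
                       (con four :* (m₁ :* k₁) :+ ((m₁ :+ m₁) :* u₂ :+ (m₂ :+ m₂) :* u₁))
                         :+ (con four :* (m₂ :* k₂) :+ ((m₂ :+ m₂) :* u₁ :+ (m₁ :+ m₁) :* u₂))
                       := con four :* (((m₁ :* k₁ :+ m₂ :* k₂) :+ m₂ :* u₁) :+ m₁ :* u₂))
                     refl M₁ M₂ K₁ K₂ μ₁ μ₂ ⟩
        four *q (((M₁ *q K₁ +q M₂ *q K₂) +q M₂ *q μ₁) +q M₁ *q μ₂)
          ∎)
        where
        open ≡-Reasoning
        four = ℕtoℚ 4
        M₁ = ℕtoℚ (edges G₁)
        M₂ = ℕtoℚ (edges G₂)
        T₁ = ∑ (degℚ G₁)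
        T₂ = ∑ (degℚ G₂)
        K = kemeny H X
        K₁ = kemeny G₁ X₁
        K₂ = kemeny G₂ X₂
        μ₁ = moment G₁ X₁ v₁
        μ₂ = moment G₂ X₂ v₂
        m≥1 : edges H ≥ 1
        m≥1 = subst (_≥ 1) (sym edges-oneSum) (ℕP.≤-trans m₁≥1 (ℕP.m≤m+n (edges G₁) (edges G₂)))

kemeny-difference-scaled : ∀ M₁ M₂ L {K K̂ K₁ K₂ K̂₂ μ₁ μ₂ μ̂₂ : ℚ} →
  (M₁ +q M₂) *q K ≡ ((M₁ *q K₁ +q M₂ *q K₂) +q M₂ *q μ₁) +q M₁ *q μ₂ →
  (M₁ +q (M₂ +q L)) *q K̂ ≡ ((M₁ *q K₁ +q (M₂ +q L) *q K̂₂) +q (M₂ +q L) *q μ₁) +q M₁ *q μ̂₂ →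
  let A = μ̂₂ -q μ₂; B = K̂₂ -q μ₂; C = K̂₂ -q K₂ in
  (K̂ -q K) *q ((M₁ +q M₂) *q ((M₁ +q M₂) +q L))
  ≡ (L *q M₁) *q (μ₁ -q K₁)
    +q (((A *q (M₁ *q M₁)) +q ((((A +q C) *q M₂) +q (B *q L)) *q M₁)) +q (C *q ((M₂ *q M₂) +q (L *q M₂))))
kemeny-difference-scaled M₁ M₂ L {K} {K̂} {K₁} {K₂} {K̂₂} {μ₁} {μ₂} {μ̂₂} kemeny-G kemeny-Ĝ = begin
  (K̂ -q K) *q ((M₁ +q M₂) *q ((M₁ +q M₂) +q L))
    ≡⟨ solve 5 (λ k̂ k x y z → (k̂ :- k) :* ((x :+ y) :* ((x :+ y) :+ z))
                              := (x :+ y) :* ((x :+ (y :+ z)) :* k̂) :- ((x :+ y) :+ z) :* ((x :+ y) :* k)) refl K̂ K M₁ M₂ L ⟩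
  (M₁ +q M₂) *q ((M₁ +q (M₂ +q L)) *q K̂) -q ((M₁ +q M₂) +q L) *q ((M₁ +q M₂) *q K)
    ≡⟨ cong₂ (λ u v → (M₁ +q M₂) *q u -q ((M₁ +q M₂) +q L) *q v) kemeny-Ĝ kemeny-G ⟩
  (M₁ +q M₂) *q (((M₁ *q K₁ +q (M₂ +q L) *q K̂₂) +q (M₂ +q L) *q μ₁) +q M₁ *q μ̂₂)
    -q ((M₁ +q M₂) +q L) *q (((M₁ *q K₁ +q M₂ *q K₂) +q M₂ *q μ₁) +q M₁ *q μ₂)
    ≡⟨ solve 9 (λ x y z k₁ k₂ k̂₂ u₁ u₂ û₂ →
                 (x :+ y) :* (((x :* k₁ :+ (y :+ z) :* k̂₂) :+ (y :+ z) :* u₁) :+ x :* û₂)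
                   :- ((x :+ y) :+ z) :* (((x :* k₁ :+ y :* k₂) :+ y :* u₁) :+ x :* u₂)
                 := (z :* x) :* (u₁ :- k₁)
                    :+ ((((û₂ :- u₂) :* (x :* x)) :+ (((((û₂ :- u₂) :+ (k̂₂ :- k₂)) :* y) :+ ((k̂₂ :- u₂) :* z)) :* x))
                        :+ ((k̂₂ :- k₂) :* ((y :* y) :+ (z :* y)))))
               refl M₁ M₂ L K₁ K₂ K̂₂ μ₁ μ₂ μ̂₂ ⟩
  (L *q M₁) *q (μ₁ -q K₁)
    +q (((A *q (M₁ *q M₁)) +q ((((A +q C) *q M₂) +q (B *q L)) *q M₁)) +q (C *q ((M₂ *q M₂) +q (L *q M₂))))
    ∎
  where
  open ≡-Reasoning
  A = μ̂₂ -q μ₂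
  B = K̂₂ -q μ₂
  C = K̂₂ -q K₂

kemeny-difference : ∀ m₁ m₂ m̂₂ l → m₁ ≥ 1 → m̂₂ ≡ m₂ ℕ.+ l → {K K̂ K₁ K₂ K̂₂ μ₁ μ₂ μ̂₂ : ℚ} →
  let M₁ = ℕtoℚ m₁; M₂ = ℕtoℚ m₂; M̂₂ = ℕtoℚ m̂₂; L = ℕtoℚ l in
  (M₁ +q M₂) *q K ≡ ((M₁ *q K₁ +q M₂ *q K₂) +q M₂ *q μ₁) +q M₁ *q μ₂ →
  (M₁ +q M̂₂) *q K̂ ≡ ((M₁ *q K₁ +q M̂₂ *q K̂₂) +q M̂₂ *q μ₁) +q M₁ *q μ̂₂ →
  let A = μ̂₂ -q μ₂; B = K̂₂ -q μ₂; C = K̂₂ -q K₂; den = (m₁ ℕ.+ m₂) ℕ.* (m₁ ℕ.+ m₂ ℕ.+ l) in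
  K̂ -q K ≡ divℕ ((L *q M₁) *q (μ₁ -q K₁)) den
           +q divℕ (((A *q (M₁ *q M₁)) +q ((((A +q C) *q M₂) +q (B *q L)) *q M₁)) +q (C *q ((M₂ *q M₂) +q (L *q M₂)))) den
kemeny-difference (suc a) m₂ _ l _ refl {K} {K̂} {K₁} {K₂} {K̂₂} {μ₁} {μ₂} {μ̂₂} kemeny-G kemeny-Ĝ =
  trans (sym (divℕ-unique t (trans (cong ((K̂ -q K) *q_) den≡)
                                   (kemeny-difference-scaled M₁ M₂ L kemeny-G (subst kemeny-form (ℕtoℚ-+ m₂ l) kemeny-Ĝ)))))
        (divℕ-distrib-+ P Q (suc t))
  where
  M₁ = ℕtoℚ (suc a)
  M₂ = ℕtoℚ m₂
  L = ℕtoℚ l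
  A = μ̂₂ -q μ₂
  B = K̂₂ -q μ₂
  C = K̂₂ -q K₂
  P = (L *q M₁) *q (μ₁ -q K₁)
  Q = ((A *q (M₁ *q M₁)) +q ((((A +q C) *q M₂) +q (B *q L)) *q M₁)) +q (C *q ((M₂ *q M₂) +q (L *q M₂)))
  kemeny-form : ℚ → Set
  kemeny-form M̂₂ = (M₁ +q M̂₂) *q K̂ ≡ ((M₁ *q K₁ +q M̂₂ *q K̂₂) +q M̂₂ *q μ₁) +q M₁ *q μ̂₂
  -- suc t is (suc a + m₂) * (suc a + m₂ + l) by computation.
  t : ℕ
  t = ((a ℕ.+ m₂) ℕ.+ l) ℕ.+ (a ℕ.+ m₂) ℕ.* (suc a ℕ.+ m₂ ℕ.+ l)
  den≡ : ℕtoℚ (suc t) ≡ (M₁ +q M₂) *q ((M₁ +q M₂) +q L)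
  den≡ = trans (ℕtoℚ-* (suc a ℕ.+ m₂) (suc a ℕ.+ m₂ ℕ.+ l))
               (cong₂ _*q_ (ℕtoℚ-+ (suc a) m₂) (trans (ℕtoℚ-+ (suc a ℕ.+ m₂) l) (cong (_+q L) (ℕtoℚ-+ (suc a) m₂))))

theorem4p2 : ∀ {n₁ k : ℕ} (G₁ : Graph n₁) (G₂ : Graph (suc k)) (v₁ : Fin n₁) (v₂ : Fin (suc k))
    (𝓛 : List (Fin (suc k) × Fin (suc k))) →
    IsSimple G₁ → Connected G₁ → edges G₁ ≥ 1 →
    IsSimple G₂ → Connected G₂ → edges G₂ ≥ 1 →
    All (λ p → proj₁ p ≢ proj₂ p) 𝓛 →
    All (λ p → oneSum G₁ v₁ G₂ v₂ (emb₂ v₁ v₂ (proj₁ p)) (emb₂ v₁ v₂ (proj₂ p)) ≡ false) 𝓛 →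
    AllPairs (λ p q → ¬ SamePair p q) 𝓛 →
    (X₁ : Mat n₁) → IsPseudoInverse (laplacian G₁) X₁ →
    (X₂ : Mat (suc k)) → IsPseudoInverse (laplacian G₂) X₂ →
    (X̂₂ : Mat (suc k)) → IsPseudoInverse (laplacian (addEdges G₂ 𝓛)) X̂₂ →
    (X : Mat (n₁ Data.Nat.+ k)) → IsPseudoInverse (laplacian (oneSum G₁ v₁ G₂ v₂)) X →
    (X̂ : Mat (n₁ Data.Nat.+ k)) →
      IsPseudoInverse (laplacian (addEdges (oneSum G₁ v₁ G₂ v₂) (map (mapPair (emb₂ v₁ v₂)) 𝓛))) X̂ →
    let m₁ = edges G₁
        m₂ = edges G₂
        m  = m₁ Data.Nat.+ m₂
        l  = length 𝓛
        G  = oneSum G₁ v₁ G₂ v₂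
        Ĝ  = addEdges G (map (mapPair (emb₂ v₁ v₂)) 𝓛)
        Ĝ₂ = addEdges G₂ 𝓛
        A  = moment Ĝ₂ X̂₂ v₂ -q moment G₂ X₂ v₂
        B  = kemeny Ĝ₂ X̂₂ -q moment G₂ X₂ v₂
        C  = kemeny Ĝ₂ X̂₂ -q kemeny G₂ X₂
        M₁ = ℕtoℚ m₁
        M₂ = ℕtoℚ m₂
        L  = ℕtoℚ l
        den = m Data.Nat.* (m Data.Nat.+ l)
    in kemeny Ĝ X̂ -q kemeny G X
       ≡ divℕ ((L *q M₁) *q (moment G₁ X₁ v₁ -q kemeny G₁ X₁)) den
         +q divℕ (((A *q (M₁ *q M₁)) +q ((((A +q C) *q M₂) +q (B *q L)) *q M₁))
                  +q (C *q ((M₂ *q M₂) +q (L *q M₂)))) den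
theorem4p2 G₁ G₂ v₁ v₂ 𝓛 simple₁ connected₁ m₁≥1 simple₂ connected₂ m₂≥1 distinct nonEdges unique
           X₁ pinv₁ X₂ pinv₂ X̂₂ p̂inv₂ X pinv X̂ p̂inv =
  kemeny-difference (edges G₁) (edges G₂) (edges Ĝ₂) (length 𝓛) m₁≥1 edges-Ĝ₂
    (G.kemeny-oneSum simple₁ simple₂ (λ _ _ → refl) connected₁ connected₂ X₁ X₂ X
                     (pseudoInverse⇒generalizedInverse pinv₁) (pseudoInverse⇒generalizedInverse pinv₂)
                     (pseudoInverse⇒generalizedInverse pinv) m₁≥1 m₂≥1)
    (Ĝ.kemeny-oneSum simple₁ ŝimple₂ (G.addEdges-oneSum 𝓛) connected₁ (addEdges-connected 𝓛 connected₂) X₁ X̂₂ X̂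
                     (pseudoInverse⇒generalizedInverse pinv₁) (pseudoInverse⇒generalizedInverse p̂inv₂)
                     (pseudoInverse⇒generalizedInverse p̂inv) m₁≥1 m̂₂≥1)
  where
  module G = OneSum G₁ G₂ v₁ v₂
  Ĝ₂ = addEdges G₂ 𝓛
  module Ĝ = OneSum G₁ Ĝ₂ v₁ v₂
  ŝimple₂ = addEdges-simple simple₂ distinct
  edges-Ĝ₂ : edges Ĝ₂ ≡ edges G₂ ℕ.+ length 𝓛
  edges-Ĝ₂ = edges-addEdges simple₂ distinct (All.map G.e₂-nonEdge nonEdges) unique
  m̂₂≥1 : edges Ĝ₂ ≥ 1
  m̂₂≥1 = subst (_≥ 1) (sym edges-Ĝ₂) (ℕP.≤-trans m₂≥1 (ℕP.m≤m+n (edges G₂) (length 𝓛)))
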